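{- Let $p$ be a prime, $M=M[A]$ a simple, coloopless, 3-connected $p$-matroid on ground set $E$ with $|E|>4$, $a,b\in E$ distinct, $\alpha\in GF(p)$ nonzero, $e\in\{a,b\}$. Then the $es$-splitting matroid $M^e_{a,b}$ is 3-connected.
   Context: A $p$-matroid is a matroid representable over $GF(p)$, $A$ a representing matrix over $GF(p)$ with columns indexed by $E$. $A'_{a,b}$ is obtained from $A$ by appending a last row with $\alpha$ in columns $a,b$ and $0$ elsewhere, then a column $z$ with last coordinate $\alpha$ and $0$ elsewhere. $A^e_{a,b}$ is obtained from $A'_{a,b}$ by appending a column $\gamma$ = (column of $e$) $-$ (column $z$); $M^e_{a,b}$ is the vector matroid of $A^e_{a,b}$ on $E\cup\{z,\gamma\}$. A $k$-separation of a matroid $N$ with rank function $r$ is a partition $\{S,T\}$ of its ground set with $|S|,|T|\ge k$ and $r(S)+r(T)-r(N)<k$; $N$ is 3-connected if it has no $1$- or $2$-separation. -}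

module Defs where

open import Data.Nat using (ℕ; zero; suc; _+_; _*_; _∸_; _≤_; _<_; NonZero)
open import Data.Nat.DivMod using (_mod_)
open import Data.Fin using (Fin; toℕ; inject₁; fromℕ) renaming (zero to fzero; suc to fsuc)
import Data.Fin as F
open import Data.Fin.Subset using (Subset; _∈_; _∉_; _⊆_; ∁; ∣_∣; ⊤)
open import Data.Bool using (if_then_else_; _∨_)
open import Data.Product using (Σ; _×_; ∃)
open import Data.Product using (Σ-syntax)
open import Relation.Nullary using (¬_; does)
open import Relation.Binary.PropositionalEquality using (_≡_; _≢_)
open import Function using (_∘_)

-- Case analysis on Fin (suc n): the LAST index (fromℕ n) versus an old index (inject₁ i).
caseLast : ∀ {n} {B : Set} → (Fin n → B) → B → Fin (suc n) → B
caseLast {zero}  f b fzero    = b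
caseLast {suc n} f b fzero    = f fzero
caseLast {suc n} f b (fsuc i) = caseLast (f ∘ fsuc) b i

module _ (p : ℕ) .{{_ : NonZero p}} where

  GF : Set
  GF = Fin p

  0F : GF
  0F = 0 mod p

  _+F_ : GF → GF → GF
  x +F y = (toℕ x + toℕ y) mod p

  _*F_ : GF → GF → GF
  x *F y = (toℕ x * toℕ y) mod p

  -F_ : GF → GF
  -F x = (p ∸ toℕ x) mod p

  _-F_ : GF → GF → GF
  x -F y = x +F (-F y)

  ΣF : ∀ {n} → (Fin n → GF) → GF
  ΣF {zero}  f = 0F
  ΣF {suc n} f = f fzero +F ΣF (f ∘ fsuc)

  Matrix : ℕ → ℕ → Set
  Matrix m n = Fin m → Fin n → GF

  Independent : ∀ {m n} → Matrix m n → Subset n → Set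
  Independent {m} {n} A S =
    (c : Fin n → GF) → (∀ j → j ∉ S → c j ≡ 0F) →
    (∀ i → ΣF (λ j → c j *F A i j) ≡ 0F) → ∀ j → c j ≡ 0F

  IsRank : ∀ {m n} → Matrix m n → Subset n → ℕ → Set
  IsRank {m} {n} A X k =
    (Σ[ I ∈ Subset n ] (I ⊆ X × Independent A I × ∣ I ∣ ≡ k)) ×
    (∀ (I : Subset n) → I ⊆ X → Independent A I → ∣ I ∣ ≤ k)

  Circuit : ∀ {m n} → Matrix m n → Subset n → Set
  Circuit {m} {n} A C =
    ¬ Independent A C × (∀ (D : Subset n) → D ⊆ C → D ≢ C → Independent A D)

  -- simple: no loops and no parallel pairs, i.e. no circuit of size ≤ 2
  Simple : ∀ {m n} → Matrix m n → Set
  Simple {m} {n} A = ∀ (C : Subset n) → Circuit A C → 2 < ∣ C ∣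

  Coloop : ∀ {m n} → Matrix m n → Fin n → Set
  Coloop {m} {n} A e = ∀ (C : Subset n) → Circuit A C → e ∉ C

  Coloopless : ∀ {m n} → Matrix m n → Set
  Coloopless {m} {n} A = ∀ (e : Fin n) → ¬ Coloop A e

  Separation : ∀ {m n} → ℕ → Matrix m n → Subset n → Set
  Separation {m} {n} k A S =
    k ≤ ∣ S ∣ × k ≤ ∣ ∁ S ∣ ×
    (Σ[ rS ∈ ℕ ] Σ[ rT ∈ ℕ ] Σ[ rE ∈ ℕ ]
      (IsRank A S rS × IsRank A (∁ S) rT × IsRank A ⊤ rE × rS + rT < k + rE))

  ThreeConnected : ∀ {m n} → Matrix m n → Set
  ThreeConnected {m} {n} A = ∀ (S : Subset n) → ¬ Separation 1 A S × ¬ Separation 2 A S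

  -- A'_{a,b}: append last row (α in columns a,b, 0 elsewhere), then last column z
  -- (α in last row, 0 elsewhere)
  A′ : ∀ {m n} → Matrix m n → Fin n → Fin n → GF → Matrix (suc m) (suc n)
  A′ {m} {n} A a b α i j =
    caseLast
      (λ i′ → caseLast (λ j′ → A i′ j′) 0F j)
      (caseLast (λ j′ → if does (j′ F.≟ a) ∨ does (j′ F.≟ b) then α else 0F) α j)
      i

  -- A^e_{a,b}: append column γ = (column of e) − (column z); ground set E ∪ {z, γ}
  -- with z = fromℕ n (as inject₁) and γ = the last index.
  Aᵉ : ∀ {m n} → Matrix m n → Fin n → Fin n → GF → Fin n → Matrix (suc m) (suc (suc n))
  Aᵉ {m} {n} A a b α e i j =
    caseLast (λ j′ → A′ A a b α i j′)
             (A′ A a b α i (inject₁ e) -F A′ A a b α i (fromℕ n))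
             j

{-# OPTIONS --safe #-}
module Submission where

-- M[Aᵉ] is M with one extra row ρ (α on a and b, 𝟘 elsewhere) and two extra columns z = (0, α) and
-- γ = (e, 0), so e = z + γ; appending a row raises ranks by at most one, hence r(M[Aᵉ]) ≤ r(M) + 1.
-- Let {S, T} be a k-separation (k ≤ 2) of M[Aᵉ] with z ∈ S, and S₀ = S ∩ E. If S₀ and E − S₀ both
-- have at least k elements, then r(S) ≥ r(S₀) + 1 and r(T) ≥ r(E − S₀), and 3-connectedness of M
-- gives r(S) + r(T) ≥ k + r(M) + 1. Otherwise one side meets E in at most one element x; the other
-- side contains E − x, which spans M, and a basis of E − {x, f} (f the other element of {a, b})
-- extended by e, f or γ is independent of size r(M) + 1 there; small independent sets built from
-- z, γ and x bound the rank of the first side.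

open import Defs
open import Data.Nat as ℕ using (ℕ; zero; suc; NonZero; _+_; _∸_; _%_; _≤_; _<_; z≤n; s≤s)
import Data.Nat.Properties as ℕₚ
open import Data.Nat.DivMod using (_mod_; %-distribˡ-+; %-distribˡ-*; m<n⇒m%n≡m; n%n≡0; m%n<n)
open import Data.Nat.Divisibility using (_∣_; m%n≡0⇒n∣m; ∣⇒≤)
open import Data.Nat.Primality using (Prime; euclidsLemma; prime⇒nonTrivial)
open import Data.Fin as F using (Fin; toℕ; fromℕ; inject₁) renaming (zero to fz; suc to fs)
open import Data.Fin.Properties using (toℕ-fromℕ<; toℕ<n; toℕ-injective; suc-injective; any?; all?)
import Data.Vec.Functional as VF
open import Data.Fin.Subset using (Subset; _∈_; _∉_; _⊆_; ∣_∣; ⊥; ⊤; ∁; ⁅_⁆; _∪_; _-_)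
open import Data.Fin.Subset.Properties
open import Data.Vec using ([]; _∷_; here; there)
open import Data.Bool using (Bool; true; false; not; _∨_; if_then_else_)
open import Data.Bool.Properties using (not-involutive)
open import Data.Product using (Σ; Σ-syntax; ∃; _×_; _,_; proj₁; proj₂)
open import Data.Sum using (_⊎_; inj₁; inj₂; [_,_]′)
open import Data.Empty using (⊥-elim)
open import Function using (_∘_; id; case_of_)
open import Relation.Binary.PropositionalEquality
open import Relation.Nullary using (¬_; yes; no; Dec; does)
open import Relation.Nullary.Decidable using (_×-dec_; ¬?)

module GFp (p : ℕ) .{{_ : NonZero p}} where

  infixl 6 _⊕_
  infixl 7 _⊗_
  infix 4 _≈_

  _⊕_ : GF p → GF p → GF p
  _⊕_ = _+F_ p

  _⊗_ : GF p → GF p → GF p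
  _⊗_ = _*F_ p

  ⊖ : GF p → GF p
  ⊖ = -F_ p

  𝟘 : GF p
  𝟘 = 0F p

  𝟙 : GF p
  𝟙 = 1 mod p

  -- Every law of GF p is transported from ℕ through this relation.
  _≈_ : GF p → ℕ → Set
  x ≈ m = toℕ x ≡ m % p

  toℕ-mod : ∀ m → toℕ (m mod p) ≡ m % p
  toℕ-mod m = toℕ-fromℕ< (m%n<n m p)

  ≈-toℕ : ∀ x → x ≈ toℕ x
  ≈-toℕ x = sym (m<n⇒m%n≡m (toℕ<n x))

  ≈-⊕ : ∀ {x y m k} → x ≈ m → y ≈ k → x ⊕ y ≈ m + k
  ≈-⊕ {x} {y} {m} {k} x≈m y≈k = trans (toℕ-mod (toℕ x + toℕ y))
    (trans (cong₂ (λ u v → (u + v) % p) x≈m y≈k) (sym (%-distribˡ-+ m k p)))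

  ≈-⊗ : ∀ {x y m k} → x ≈ m → y ≈ k → x ⊗ y ≈ m ℕ.* k
  ≈-⊗ {x} {y} {m} {k} x≈m y≈k = trans (toℕ-mod (toℕ x ℕ.* toℕ y))
    (trans (cong₂ (λ u v → (u ℕ.* v) % p) x≈m y≈k) (sym (%-distribˡ-* m k p)))

  ≈-injective : ∀ {x y m k} → x ≈ m → y ≈ k → m % p ≡ k % p → x ≡ y
  ≈-injective x≈m y≈k eq = toℕ-injective (trans x≈m (trans eq (sym y≈k)))

  ≈-lift : ∀ {x y m k} → x ≈ m → y ≈ k → m ≡ k → x ≡ y
  ≈-lift x≈m y≈k refl = ≈-injective x≈m y≈k refl

  ⊕-comm : ∀ x y → x ⊕ y ≡ y ⊕ x
  ⊕-comm x y = ≈-lift (≈-⊕ (≈-toℕ x) (≈-toℕ y)) (≈-⊕ (≈-toℕ y) (≈-toℕ x)) (ℕₚ.+-comm (toℕ x) _)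

  ⊕-assoc : ∀ x y z → x ⊕ y ⊕ z ≡ x ⊕ (y ⊕ z)
  ⊕-assoc x y z = ≈-lift (≈-⊕ (≈-⊕ (≈-toℕ x) (≈-toℕ y)) (≈-toℕ z))
    (≈-⊕ (≈-toℕ x) (≈-⊕ (≈-toℕ y) (≈-toℕ z))) (ℕₚ.+-assoc (toℕ x) _ _)

  ⊗-comm : ∀ x y → x ⊗ y ≡ y ⊗ x
  ⊗-comm x y = ≈-lift (≈-⊗ (≈-toℕ x) (≈-toℕ y)) (≈-⊗ (≈-toℕ y) (≈-toℕ x)) (ℕₚ.*-comm (toℕ x) _)

  ⊗-assoc : ∀ x y z → x ⊗ y ⊗ z ≡ x ⊗ (y ⊗ z)
  ⊗-assoc x y z = ≈-lift (≈-⊗ (≈-⊗ (≈-toℕ x) (≈-toℕ y)) (≈-toℕ z))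
    (≈-⊗ (≈-toℕ x) (≈-⊗ (≈-toℕ y) (≈-toℕ z))) (ℕₚ.*-assoc (toℕ x) _ _)

  ⊗-distribˡ-⊕ : ∀ x y z → x ⊗ (y ⊕ z) ≡ x ⊗ y ⊕ x ⊗ z
  ⊗-distribˡ-⊕ x y z = ≈-lift (≈-⊗ (≈-toℕ x) (≈-⊕ (≈-toℕ y) (≈-toℕ z)))
    (≈-⊕ (≈-⊗ (≈-toℕ x) (≈-toℕ y)) (≈-⊗ (≈-toℕ x) (≈-toℕ z))) (ℕₚ.*-distribˡ-+ (toℕ x) _ _)

  ⊗-distribʳ-⊕ : ∀ x y z → (y ⊕ z) ⊗ x ≡ y ⊗ x ⊕ z ⊗ x
  ⊗-distribʳ-⊕ x y z =
    trans (⊗-comm _ x) (trans (⊗-distribˡ-⊕ x y z) (cong₂ _⊕_ (⊗-comm x y) (⊗-comm x z)))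

  ⊕-identityˡ : ∀ x → 𝟘 ⊕ x ≡ x
  ⊕-identityˡ x = ≈-lift (≈-⊕ (toℕ-mod 0) (≈-toℕ x)) (≈-toℕ x) refl

  ⊕-identityʳ : ∀ x → x ⊕ 𝟘 ≡ x
  ⊕-identityʳ x = trans (⊕-comm x 𝟘) (⊕-identityˡ x)

  ⊗-zeroˡ : ∀ x → 𝟘 ⊗ x ≡ 𝟘
  ⊗-zeroˡ x = ≈-lift (≈-⊗ (toℕ-mod 0) (≈-toℕ x)) (toℕ-mod 0) refl

  ⊗-zeroʳ : ∀ x → x ⊗ 𝟘 ≡ 𝟘
  ⊗-zeroʳ x = trans (⊗-comm x 𝟘) (⊗-zeroˡ x)

  0%p≡0 : 0 % p ≡ 0
  0%p≡0 = m<n⇒m%n≡m (ℕₚ.n≢0⇒n>0 (ℕ.≢-nonZero⁻¹ p))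

  ⊖-inverseʳ : ∀ x → x ⊕ ⊖ x ≡ 𝟘
  ⊖-inverseʳ x = ≈-injective (≈-⊕ (≈-toℕ x) (toℕ-mod (p ∸ toℕ x))) (toℕ-mod 0)
    (trans (cong (_% p) (ℕₚ.m+[n∸m]≡n (ℕₚ.<⇒≤ (toℕ<n x)))) (trans (n%n≡0 p) (sym 0%p≡0)))

  ⊖-inverseˡ : ∀ x → ⊖ x ⊕ x ≡ 𝟘
  ⊖-inverseˡ x = trans (⊕-comm _ x) (⊖-inverseʳ x)

  ⊕-cancelʳ : ∀ x y z → x ⊕ z ≡ y ⊕ z → x ≡ y
  ⊕-cancelʳ x y z eq = begin
    x                ≡⟨ sym (⊕-identityʳ x) ⟩
    x ⊕ 𝟘            ≡⟨ cong (x ⊕_) (sym (⊖-inverseʳ z)) ⟩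
    x ⊕ (z ⊕ ⊖ z)    ≡⟨ sym (⊕-assoc x z _) ⟩
    x ⊕ z ⊕ ⊖ z      ≡⟨ cong (_⊕ ⊖ z) eq ⟩
    y ⊕ z ⊕ ⊖ z      ≡⟨ ⊕-assoc y z _ ⟩
    y ⊕ (z ⊕ ⊖ z)    ≡⟨ cong (y ⊕_) (⊖-inverseʳ z) ⟩
    y ⊕ 𝟘            ≡⟨ ⊕-identityʳ y ⟩
    y                ∎
    where open ≡-Reasoning

  x⊕y≡𝟘⇒x≡⊖y : ∀ x y → x ⊕ y ≡ 𝟘 → x ≡ ⊖ y
  x⊕y≡𝟘⇒x≡⊖y x y eq = ⊕-cancelʳ x (⊖ y) y (trans eq (sym (⊖-inverseˡ y)))

  ⊖-distribˡ-⊗ : ∀ x y → ⊖ x ⊗ y ≡ ⊖ (x ⊗ y)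
  ⊖-distribˡ-⊗ x y = x⊕y≡𝟘⇒x≡⊖y _ _
    (trans (sym (⊗-distribʳ-⊕ y (⊖ x) x)) (trans (cong (_⊗ y) (⊖-inverseˡ x)) (⊗-zeroˡ y)))

  ⊖-𝟘 : ⊖ 𝟘 ≡ 𝟘
  ⊖-𝟘 = sym (x⊕y≡𝟘⇒x≡⊖y 𝟘 𝟘 (⊕-identityˡ 𝟘))

  ⊖-involutive : ∀ x → ⊖ (⊖ x) ≡ x
  ⊖-involutive x = sym (x⊕y≡𝟘⇒x≡⊖y x (⊖ x) (⊖-inverseʳ x))

  ⊖x≡𝟘⇒x≡𝟘 : ∀ x → ⊖ x ≡ 𝟘 → x ≡ 𝟘
  ⊖x≡𝟘⇒x≡𝟘 x eq = trans (sym (⊖-involutive x)) (trans (cong ⊖ eq) ⊖-𝟘)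

  x⊖𝟘≡x : ∀ x → x ⊕ ⊖ 𝟘 ≡ x
  x⊖𝟘≡x x = trans (cong (x ⊕_) ⊖-𝟘) (⊕-identityʳ x)

  x⊗y⊖y⊗x≡𝟘 : ∀ x y → x ⊗ y ⊕ ⊖ y ⊗ x ≡ 𝟘
  x⊗y⊖y⊗x≡𝟘 x y =
    trans (cong (x ⊗ y ⊕_) (trans (⊖-distribˡ-⊗ y x) (cong ⊖ (⊗-comm y x)))) (⊖-inverseʳ (x ⊗ y))

  x⊗y⊖x⊗y≡𝟘 : ∀ x y → x ⊗ y ⊕ ⊖ x ⊗ y ≡ 𝟘
  x⊗y⊖x⊗y≡𝟘 x y = trans (sym (⊗-distribʳ-⊕ y x (⊖ x))) (trans (cong (_⊗ y) (⊖-inverseʳ x)) (⊗-zeroˡ y))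

  ⊕-interchange : ∀ w x y z → (w ⊕ x) ⊕ (y ⊕ z) ≡ (w ⊕ y) ⊕ (x ⊕ z)
  ⊕-interchange w x y z = begin
    (w ⊕ x) ⊕ (y ⊕ z)  ≡⟨ ⊕-assoc w x _ ⟩
    w ⊕ (x ⊕ (y ⊕ z))  ≡⟨ cong (w ⊕_) (sym (⊕-assoc x y z)) ⟩
    w ⊕ ((x ⊕ y) ⊕ z)  ≡⟨ cong (λ u → w ⊕ (u ⊕ z)) (⊕-comm x y) ⟩
    w ⊕ ((y ⊕ x) ⊕ z)  ≡⟨ cong (w ⊕_) (⊕-assoc y x z) ⟩
    w ⊕ (y ⊕ (x ⊕ z))  ≡⟨ sym (⊕-assoc w y _) ⟩
    (w ⊕ y) ⊕ (x ⊕ z)  ∎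
    where open ≡-Reasoning

  x⊕𝟘⊗y≡x : ∀ x y → x ⊕ 𝟘 ⊗ y ≡ x
  x⊕𝟘⊗y≡x x y = trans (cong (x ⊕_) (⊗-zeroˡ y)) (⊕-identityʳ x)

  x⊕y⊗z≡𝟘∧y≡𝟘⇒x≡𝟘 : ∀ {x y} z → y ≡ 𝟘 → x ⊕ y ⊗ z ≡ 𝟘 → x ≡ 𝟘
  x⊕y⊗z≡𝟘∧y≡𝟘⇒x≡𝟘 {x} z refl eq = trans (sym (x⊕𝟘⊗y≡x x z)) eq

  module _ (pr : Prime p) where

    p∣toℕ⇒≡𝟘 : ∀ x → p ∣ toℕ x → x ≡ 𝟘
    p∣toℕ⇒≡𝟘 x p∣x with toℕ x in eq
    ... | zero  = ≈-lift (≈-toℕ x) (toℕ-mod 0) eq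
    ... | suc _ = ⊥-elim (ℕₚ.<⇒≱ (subst (_< p) eq (toℕ<n x)) (∣⇒≤ p∣x))

    x⊗y≡𝟘⇒x≡𝟘⊎y≡𝟘 : ∀ x y → x ⊗ y ≡ 𝟘 → x ≡ 𝟘 ⊎ y ≡ 𝟘
    x⊗y≡𝟘⇒x≡𝟘⊎y≡𝟘 x y eq
      with euclidsLemma (toℕ x) (toℕ y) pr
             (m%n≡0⇒n∣m _ p (trans (sym (toℕ-mod _)) (trans (cong toℕ eq) (trans (toℕ-mod 0) 0%p≡0))))
    ... | inj₁ p∣x = inj₁ (p∣toℕ⇒≡𝟘 x p∣x)
    ... | inj₂ p∣y = inj₂ (p∣toℕ⇒≡𝟘 y p∣y)

    x≢𝟘∧x⊗y≡𝟘⇒y≡𝟘 : ∀ x y → x ≢ 𝟘 → x ⊗ y ≡ 𝟘 → y ≡ 𝟘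
    x≢𝟘∧x⊗y≡𝟘⇒y≡𝟘 x y x≢𝟘 eq with x⊗y≡𝟘⇒x≡𝟘⊎y≡𝟘 x y eq
    ... | inj₁ x≡𝟘 = ⊥-elim (x≢𝟘 x≡𝟘)
    ... | inj₂ y≡𝟘 = y≡𝟘

    y≢𝟘∧x⊗y≡𝟘⇒x≡𝟘 : ∀ x y → y ≢ 𝟘 → x ⊗ y ≡ 𝟘 → x ≡ 𝟘
    y≢𝟘∧x⊗y≡𝟘⇒x≡𝟘 x y y≢𝟘 eq = x≢𝟘∧x⊗y≡𝟘⇒y≡𝟘 y x y≢𝟘 (trans (⊗-comm y x) eq)

    x⊕y⊗z≡𝟘∧x≡𝟘⇒y≡𝟘 : ∀ {x y z} → z ≢ 𝟘 → x ≡ 𝟘 → x ⊕ y ⊗ z ≡ 𝟘 → y ≡ 𝟘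
    x⊕y⊗z≡𝟘∧x≡𝟘⇒y≡𝟘 {y = y} {z} z≢𝟘 refl eq =
      y≢𝟘∧x⊗y≡𝟘⇒x≡𝟘 y z z≢𝟘 (trans (sym (⊕-identityˡ _)) eq)

    𝟙≢𝟘 : 𝟙 ≢ 𝟘
    𝟙≢𝟘 eq = ℕₚ.1+n≢0
      (trans (sym 1%p≡1) (trans (sym (toℕ-mod 1)) (trans (cong toℕ eq) (trans (toℕ-mod 0) 0%p≡0))))
      where
      1%p≡1 : 1 % p ≡ 1
      1%p≡1 = m<n⇒m%n≡m (ℕ.nonTrivial⇒n>1 p {{prime⇒nonTrivial pr}})

module Sums (p : ℕ) .{{_ : NonZero p}} where
  open GFp p

  ΣF-cong : ∀ {n} {f g : Fin n → GF p} → (∀ j → f j ≡ g j) → ΣF p f ≡ ΣF p g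
  ΣF-cong {zero}  eq = refl
  ΣF-cong {suc n} eq = cong₂ _⊕_ (eq fz) (ΣF-cong (eq ∘ fs))

  ΣF-zero : ∀ {n} {f : Fin n → GF p} → (∀ j → f j ≡ 𝟘) → ΣF p f ≡ 𝟘
  ΣF-zero {zero}  eq = refl
  ΣF-zero {suc n} eq = trans (cong₂ _⊕_ (eq fz) (ΣF-zero (eq ∘ fs))) (⊕-identityˡ 𝟘)

  ΣF-⊕ : ∀ {n} (f g : Fin n → GF p) → ΣF p (λ j → f j ⊕ g j) ≡ ΣF p f ⊕ ΣF p g
  ΣF-⊕ {zero}  f g = sym (⊕-identityˡ 𝟘)
  ΣF-⊕ {suc n} f g = trans (cong (f fz ⊕ g fz ⊕_) (ΣF-⊕ (f ∘ fs) (g ∘ fs)))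
    (⊕-interchange (f fz) (g fz) (ΣF p (f ∘ fs)) (ΣF p (g ∘ fs)))

  ΣF-⊗ : ∀ {n} k (f : Fin n → GF p) → ΣF p (λ j → k ⊗ f j) ≡ k ⊗ ΣF p f
  ΣF-⊗ {zero}  k f = sym (⊗-zeroʳ k)
  ΣF-⊗ {suc n} k f = trans (cong (k ⊗ f fz ⊕_) (ΣF-⊗ k (f ∘ fs))) (sym (⊗-distribˡ-⊕ k _ _))

  ΣF-single : ∀ {n} (f : Fin n → GF p) w → (∀ j → j ≢ w → f j ≡ 𝟘) → ΣF p f ≡ f w
  ΣF-single {suc n} f fz     off = trans (cong (f fz ⊕_) (ΣF-zero (λ j → off (fs j) λ ()))) (⊕-identityʳ _)
  ΣF-single {suc n} f (fs w) off = trans (cong (_⊕ ΣF p (f ∘ fs)) (off fz λ ()))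
    (trans (⊕-identityˡ _) (ΣF-single (f ∘ fs) w (λ j j≢w → off (fs j) (j≢w ∘ suc-injective))))

  ΣF-last : ∀ {n} (f : Fin (suc n) → GF p) → ΣF p f ≡ ΣF p (f ∘ inject₁) ⊕ f (fromℕ n)
  ΣF-last {zero}  f = trans (⊕-identityʳ (f fz)) (sym (⊕-identityˡ (f fz)))
  ΣF-last {suc n} f = trans (cong (f fz ⊕_) (ΣF-last (f ∘ fs)))
    (sym (⊕-assoc (f fz) (ΣF p (f ∘ fs ∘ inject₁)) (f (fromℕ (suc n)))))

  infix 7 _·_

  _·_ : ∀ {n} → (Fin n → GF p) → (Fin n → GF p) → GF p
  c · w = ΣF p (λ j → c j ⊗ w j)

  ·-congˡ : ∀ {n} {c d : Fin n → GF p} w → (∀ j → c j ≡ d j) → c · w ≡ d · w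
  ·-congˡ w eq = ΣF-cong (λ j → cong (_⊗ w j) (eq j))

  ·-congʳ : ∀ {n} c {w v : Fin n → GF p} → (∀ j → w j ≡ v j) → c · w ≡ c · v
  ·-congʳ c eq = ΣF-cong (λ j → cong (c j ⊗_) (eq j))

  ·-⊕ : ∀ {n} (c d w : Fin n → GF p) → (λ j → c j ⊕ d j) · w ≡ c · w ⊕ d · w
  ·-⊕ c d w = trans (ΣF-cong (λ j → ⊗-distribʳ-⊕ (w j) (c j) (d j)))
    (ΣF-⊕ (λ j → c j ⊗ w j) (λ j → d j ⊗ w j))

  ·-⊗ : ∀ {n} k (c w : Fin n → GF p) → (λ j → k ⊗ c j) · w ≡ k ⊗ (c · w)
  ·-⊗ k c w = trans (ΣF-cong (λ j → ⊗-assoc k (c j) (w j))) (ΣF-⊗ k (λ j → c j ⊗ w j))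

  ·-zero : ∀ {n} (c w : Fin n → GF p) → (∀ j → c j ≡ 𝟘) → c · w ≡ 𝟘
  ·-zero c w c≡𝟘 = ΣF-zero (λ j → trans (cong (_⊗ w j) (c≡𝟘 j)) (⊗-zeroˡ _))

  ·-single : ∀ {n} (c w : Fin n → GF p) j₀ → (∀ j → j ≢ j₀ → c j ⊗ w j ≡ 𝟘) → c · w ≡ c j₀ ⊗ w j₀
  ·-single c w = ΣF-single _

  δ : ∀ {n} → Fin n → GF p → Fin n → GF p
  δ j₀ s j = if does (j F.≟ j₀) then s else 𝟘

  δ-same : ∀ {n} (j₀ : Fin n) s → δ j₀ s j₀ ≡ s
  δ-same j₀ s with j₀ F.≟ j₀
  ... | yes _   = refl
  ... | no j₀≢j₀ = ⊥-elim (j₀≢j₀ refl)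

  δ-other : ∀ {n} (j₀ : Fin n) s j → j ≢ j₀ → δ j₀ s j ≡ 𝟘
  δ-other j₀ s j j≢j₀ with j F.≟ j₀
  ... | yes j≡j₀ = ⊥-elim (j≢j₀ j≡j₀)
  ... | no _     = refl

  δ-𝟘 : ∀ {n} (j₀ : Fin n) j → δ j₀ 𝟘 j ≡ 𝟘
  δ-𝟘 j₀ j with j F.≟ j₀
  ... | yes _ = refl
  ... | no _  = refl

  ·-δ : ∀ {n} (j₀ : Fin n) s w → δ j₀ s · w ≡ s ⊗ w j₀
  ·-δ j₀ s w = trans (·-single (δ j₀ s) w j₀ (λ j j≢j₀ → trans (cong (_⊗ w j) (δ-other j₀ s j j≢j₀)) (⊗-zeroˡ _)))
                     (cong (_⊗ w j₀) (δ-same j₀ s))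

  zero-everywhere : ∀ {n} (c : Fin n → GF p) j₀ → (∀ j → j ≢ j₀ → c j ≡ 𝟘) → c j₀ ≡ 𝟘 → ∀ j → c j ≡ 𝟘
  zero-everywhere c j₀ c-off c-j₀ j with j F.≟ j₀
  ... | yes refl = c-j₀
  ... | no j≢j₀  = c-off j j≢j₀

  erase : ∀ {n} → Fin n → (Fin n → GF p) → Fin n → GF p
  erase j₀ c j = if does (j F.≟ j₀) then 𝟘 else c j

  erase-other : ∀ {n} (j₀ : Fin n) c j → j ≢ j₀ → erase j₀ c j ≡ c j
  erase-other j₀ c j j≢j₀ with j F.≟ j₀
  ... | yes j≡j₀ = ⊥-elim (j≢j₀ j≡j₀)
  ... | no _     = refl

  erase-⊕-δ : ∀ {n} (j₀ : Fin n) c j → c j ≡ erase j₀ c j ⊕ δ j₀ (c j₀) j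
  erase-⊕-δ j₀ c j with j F.≟ j₀
  ... | yes refl = sym (⊕-identityˡ (c j))
  ... | no _     = sym (⊕-identityʳ (c j))

  ·-erase : ∀ {n} (j₀ : Fin n) c w → c · w ≡ erase j₀ c · w ⊕ c j₀ ⊗ w j₀
  ·-erase j₀ c w = trans (·-congˡ w (erase-⊕-δ j₀ c))
    (trans (·-⊕ (erase j₀ c) (δ j₀ (c j₀)) w) (cong (erase j₀ c · w ⊕_) (·-δ j₀ (c j₀) w)))

  erase-swap : ∀ {n} (j₀ : Fin n) c w → erase j₀ c · w ≡ c · erase j₀ w
  erase-swap j₀ c w = ΣF-cong swap
    where
    swap : ∀ j → erase j₀ c j ⊗ w j ≡ c j ⊗ erase j₀ w j
    swap j with j F.≟ j₀
    ... | yes _ = trans (⊗-zeroˡ (w j)) (sym (⊗-zeroʳ (c j)))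
    ... | no _  = refl

∃-function? : ∀ {p} n (P : (Fin n → Fin p) → Set) →
              (∀ f g → (∀ x → f x ≡ g x) → P f → P g) → (∀ f → Dec (P f)) → Dec (∃ P)
∃-function? zero P resp P? with P? (λ ())
... | yes Pf = yes (_ , Pf)
... | no ¬Pf = no λ (f , Pf) → ¬Pf (resp f _ (λ ()) Pf)
∃-function? (suc n) P resp P?
  with any? (λ a → ∃-function? n (P ∘ VF._∷_ a)
                     (λ f g f≗g → resp _ _ λ { fz → refl ; (fs i) → f≗g i }) (P? ∘ VF._∷_ a))
... | yes (a , f , Pf) = yes (VF._∷_ a f , Pf)
... | no ¬Pf = no λ (f , Pf) → ¬Pf (f fz , f ∘ fs , resp f _ (λ { fz → refl ; (fs i) → refl }) Pf)

greatest : (Q : ℕ → Set) → (∀ k → Dec (Q k)) → Q 0 → ∀ j → (∀ k → Q k → k ≤ j) →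
           Σ ℕ λ k → Q k × (∀ k′ → Q k′ → k′ ≤ k)
greatest Q Q? Q0 j bounded with Q? j
... | yes Qj = j , Qj , bounded
greatest Q Q? Q0 zero    bounded | no ¬Qj = ⊥-elim (¬Qj Q0)
greatest Q Q? Q0 (suc j) bounded | no ¬Qj = greatest Q Q? Q0 j λ k Qk →
  ℕₚ.≤-pred (ℕₚ.≤∧≢⇒< (bounded k Qk) (λ k≡j → ¬Qj (subst Q k≡j Qk)))

module VectorMatroid (p : ℕ) .{{_ : NonZero p}} {m n : ℕ} (B : Matrix p m n) where
  open GFp p
  open Sums p using (_·_; ·-congˡ)

  Dependence : Subset n → (Fin n → GF p) → Set
  Dependence S c = (∀ j → j ∉ S → c j ≡ 𝟘) × (∀ i → c · B i ≡ 𝟘) × ∃ (λ j → c j ≢ 𝟘)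

  independent-or-dependence : ∀ S → Independent p B S ⊎ ∃ (Dependence S)
  independent-or-dependence S with ∃-function? n (Dependence S) respects dependence?
    where
    respects : ∀ f g → (∀ x → f x ≡ g x) → Dependence S f → Dependence S g
    respects f g f≗g (supp , rows , j , fj≢𝟘) =
      (λ j j∉S → trans (sym (f≗g j)) (supp j j∉S)) ,
      (λ i → trans (sym (·-congˡ (B i) f≗g)) (rows i)) ,
      j , (λ gj≡𝟘 → fj≢𝟘 (trans (f≗g j) gj≡𝟘))
    supported? : ∀ c j → Dec (j ∉ S → c j ≡ 𝟘)
    supported? c j with j ∈? S | c j F.≟ 𝟘
    ... | _       | yes cj≡𝟘 = yes (λ _ → cj≡𝟘)
    ... | yes j∈S | no _     = yes (λ j∉S → ⊥-elim (j∉S j∈S))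
    ... | no j∉S  | no cj≢𝟘  = no (λ supp → cj≢𝟘 (supp j∉S))
    dependence? : ∀ c → Dec (Dependence S c)
    dependence? c = all? (supported? c) ×-dec
      (all? (λ i → c · B i F.≟ 𝟘) ×-dec any? (λ j → ¬? (c j F.≟ 𝟘)))
  ... | yes dep = inj₂ dep
  ... | no ¬dep = inj₁ λ c supp rows j → case c j F.≟ 𝟘 of λ where
    (yes cj≡𝟘) → cj≡𝟘
    (no cj≢𝟘)  → ⊥-elim (¬dep (c , supp , rows , j , cj≢𝟘))

  independent? : ∀ S → Dec (Independent p B S)
  independent? S with independent-or-dependence S
  ... | inj₁ ind = yes ind
  ... | inj₂ (c , supp , rows , j , cj≢𝟘) = no λ ind → cj≢𝟘 (ind c supp rows j)

  rank : ∀ X → Σ ℕ (IsRank p B X)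
  rank X with greatest HasIndependentOfSize hasIndependentOfSize? empty n bounded
    where
    HasIndependentOfSize : ℕ → Set
    HasIndependentOfSize k = Σ[ I ∈ Subset n ] (I ⊆ X × Independent p B I × ∣ I ∣ ≡ k)
    hasIndependentOfSize? : ∀ k → Dec (HasIndependentOfSize k)
    hasIndependentOfSize? k = anySubset? (λ I → (I ⊆? X) ×-dec (independent? I ×-dec (∣ I ∣ ℕ.≟ k)))
    empty : HasIndependentOfSize 0
    empty = ⊥ , (λ x∈⊥ → ⊥-elim (∉⊥ x∈⊥)) , (λ c supp _ j → supp j ∉⊥) , ∣⊥∣≡0 n
    bounded : ∀ k → HasIndependentOfSize k → k ≤ n
    bounded k (I , _ , _ , ∣I∣≡k) = subst (_≤ n) ∣I∣≡k (∣p∣≤n I)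
  ... | k , largest , maximal = k , largest , λ I I⊆X ind → maximal ∣ I ∣ (I , I⊆X , ind , refl)

∣p∪⁅x⁆∣≡1+∣p∣ : ∀ {n} (p : Subset n) x → x ∉ p → ∣ p ∪ ⁅ x ⁆ ∣ ≡ suc ∣ p ∣
∣p∪⁅x⁆∣≡1+∣p∣ (true ∷ p)  fz     x∉p = ⊥-elim (x∉p here)
∣p∪⁅x⁆∣≡1+∣p∣ (false ∷ p) fz     x∉p = cong (λ q → suc ∣ q ∣) (∪-identityʳ p)
∣p∪⁅x⁆∣≡1+∣p∣ (true ∷ p)  (fs x) x∉p = cong suc (∣p∪⁅x⁆∣≡1+∣p∣ p x (x∉p ∘ there))
∣p∪⁅x⁆∣≡1+∣p∣ (false ∷ p) (fs x) x∉p = ∣p∪⁅x⁆∣≡1+∣p∣ p x (x∉p ∘ there)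

∣p∣≡1+∣p-x∣ : ∀ {n} (p : Subset n) x → x ∈ p → ∣ p ∣ ≡ suc ∣ p - x ∣
∣p∣≡1+∣p-x∣ (true ∷ p)  fz     here      = cong (λ q → suc ∣ q ∣) (sym (p─⊥≡p p))
∣p∣≡1+∣p-x∣ (true ∷ p)  (fs x) (there x∈p) = cong suc (∣p∣≡1+∣p-x∣ p x x∈p)
∣p∣≡1+∣p-x∣ (false ∷ p) (fs x) (there x∈p) = ∣p∣≡1+∣p-x∣ p x x∈p

x∈p-y⇒x≢y : ∀ {n} (p : Subset n) {x} y → x ∈ p - y → x ≢ y
x∈p-y⇒x≢y (_ ∷ p) fz     ()        refl
x∈p-y⇒x≢y (_ ∷ p) (fs y) (there x∈) refl = x∈p-y⇒x≢y p y x∈ refl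

x∉p⇒x∈p∪⁅y⁆⇒x≡y : ∀ {n} (p : Subset n) {x} y → x ∉ p → x ∈ p ∪ ⁅ y ⁆ → x ≡ y
x∉p⇒x∈p∪⁅y⁆⇒x≡y p y x∉p x∈ with x∈p∪q⁻ p ⁅ y ⁆ x∈
... | inj₁ x∈p  = ⊥-elim (x∉p x∈p)
... | inj₂ x∈⁅y⁆ = x∈⁅y⁆⇒x≡y y x∈⁅y⁆

x∈p⇒⁅x⁆⊆p : ∀ {n} {p : Subset n} {x} → x ∈ p → ⁅ x ⁆ ⊆ p
x∈p⇒⁅x⁆⊆p {p = p} {x} x∈p y∈⁅x⁆ = subst (_∈ p) (sym (x∈⁅y⁆⇒x≡y x y∈⁅x⁆)) x∈p

p⊆q∧x∈q⇒p∪⁅x⁆⊆q : ∀ {n} {p q : Subset n} {x} → p ⊆ q → x ∈ q → p ∪ ⁅ x ⁆ ⊆ q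
p⊆q∧x∈q⇒p∪⁅x⁆⊆q {p = p} {x = x} p⊆q x∈q y∈ with x∈p∪q⁻ p ⁅ x ⁆ y∈
... | inj₁ y∈p   = p⊆q y∈p
... | inj₂ y∈⁅x⁆ = x∈p⇒⁅x⁆⊆p x∈q y∈⁅x⁆

∁-involutive : ∀ {n} (p : Subset n) → ∁ (∁ p) ≡ p
∁-involutive []      = refl
∁-involutive (b ∷ p) = cong₂ _∷_ (not-involutive b) (∁-involutive p)

∣∁p∣+∣p∣≡n : ∀ {n} (p : Subset n) → ∣ ∁ p ∣ + ∣ p ∣ ≡ n
∣∁p∣+∣p∣≡n p = trans (cong (_+ ∣ p ∣) (∣∁p∣≡n∸∣p∣ p)) (ℕₚ.m∸n+n≡m (∣p∣≤n p))

∀x∉p⇒∣p∣≡0 : ∀ {n} (p : Subset n) → (∀ x → x ∉ p) → ∣ p ∣ ≡ 0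
∀x∉p⇒∣p∣≡0 {n} p empty = ℕₚ.n≤0⇒n≡0
  (subst (∣ p ∣ ≤_) (∣⊥∣≡0 n) (p⊆q⇒∣p∣≤∣q∣ {q = ⊥} λ {x} x∈p → ⊥-elim (empty x x∈p)))

x∈⁅y⁆∪⁅z⁆⁻ : ∀ {n} {x y z : Fin n} → x ∈ ⁅ y ⁆ ∪ ⁅ z ⁆ → x ≡ y ⊎ x ≡ z
x∈⁅y⁆∪⁅z⁆⁻ {y = y} {z} x∈ with x∈p∪q⁻ ⁅ y ⁆ ⁅ z ⁆ x∈
... | inj₁ x∈⁅y⁆ = inj₁ (x∈⁅y⁆⇒x≡y y x∈⁅y⁆)
... | inj₂ x∈⁅z⁆ = inj₂ (x∈⁅y⁆⇒x≡y z x∈⁅z⁆)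

x∈⁅x⁆∪⁅y⁆ : ∀ {n} (x y : Fin n) → x ∈ ⁅ x ⁆ ∪ ⁅ y ⁆
x∈⁅x⁆∪⁅y⁆ x y = x∈p∪q⁺ (inj₁ (x∈⁅x⁆ x))

y∈⁅x⁆∪⁅y⁆ : ∀ {n} (x y : Fin n) → y ∈ ⁅ x ⁆ ∪ ⁅ y ⁆
y∈⁅x⁆∪⁅y⁆ x y = x∈p∪q⁺ (inj₂ (x∈⁅x⁆ y))

⁅x⁆∪⁅y⁆⊆⁅y⁆∪⁅x⁆ : ∀ {n} (x y : Fin n) → ⁅ x ⁆ ∪ ⁅ y ⁆ ⊆ ⁅ y ⁆ ∪ ⁅ x ⁆
⁅x⁆∪⁅y⁆⊆⁅y⁆∪⁅x⁆ x y z∈ =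
  x∈p∪q⁺ (case x∈p∪q⁻ ⁅ x ⁆ ⁅ y ⁆ z∈ of λ { (inj₁ z∈x) → inj₂ z∈x ; (inj₂ z∈y) → inj₁ z∈y })

∣⁅x⁆∪⁅y⁆∣≡2 : ∀ {n} (x y : Fin n) → x ≢ y → ∣ ⁅ x ⁆ ∪ ⁅ y ⁆ ∣ ≡ 2
∣⁅x⁆∪⁅y⁆∣≡2 x y x≢y =
  trans (∣p∪⁅x⁆∣≡1+∣p∣ ⁅ x ⁆ y (λ y∈⁅x⁆ → x≢y (sym (x∈⁅y⁆⇒x≡y x y∈⁅x⁆)))) (cong suc (∣⁅x⁆∣≡1 x))

2≤∣p∣ : ∀ {n} (p : Subset n) {x y} → x ≢ y → x ∈ p → y ∈ p → 2 ≤ ∣ p ∣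
2≤∣p∣ p {x} {y} x≢y x∈p y∈p = subst (_≤ ∣ p ∣) (∣⁅x⁆∪⁅y⁆∣≡2 x y x≢y)
  (p⊆q⇒∣p∣≤∣q∣ (p⊆q∧x∈q⇒p∪⁅x⁆⊆q (x∈p⇒⁅x⁆⊆p x∈p) y∈p))

∣p∣≤1⇒p⊆⁅x⁆ : ∀ {n} (p : Subset n) {x} → x ∈ p → ∣ p ∣ ≤ 1 → p ⊆ ⁅ x ⁆
∣p∣≤1⇒p⊆⁅x⁆ p {x} x∈p ∣p∣≤1 {y} y∈p with y F.≟ x
... | yes refl = x∈⁅x⁆ x
... | no y≢x   = ⊥-elim (ℕₚ.<⇒≱ (s≤s ∣p∣≤1) (2≤∣p∣ p y≢x y∈p x∈p))

p⊆⁅x⁆∧1≤∣p∣⇒x∈p : ∀ {n} (p : Subset n) x → p ⊆ ⁅ x ⁆ → 1 ≤ ∣ p ∣ → x ∈ p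
p⊆⁅x⁆∧1≤∣p∣⇒x∈p {n} p x p⊆ 1≤∣p∣ with x ∈? p
... | yes x∈p = x∈p
... | no x∉p  = ⊥-elim (ℕₚ.<⇒≱ 1≤∣p∣ (ℕₚ.≤-reflexive (∀x∉p⇒∣p∣≡0 p λ y y∈p →
                  x∉p (subst (_∈ p) (x∈⁅y⁆⇒x≡y x (p⊆ y∈p)) y∈p))))

p⊆⁅x⁆∪⁅y⁆∧2≤∣p∣⇒y∈p : ∀ {n} (p : Subset n) x y → p ⊆ ⁅ x ⁆ ∪ ⁅ y ⁆ → 2 ≤ ∣ p ∣ → y ∈ p
p⊆⁅x⁆∪⁅y⁆∧2≤∣p∣⇒y∈p p x y p⊆ 2≤∣p∣ with y ∈? p
... | yes y∈p = y∈p
... | no y∉p  = ⊥-elim (ℕₚ.<⇒≱ 2≤∣p∣ (subst (∣ p ∣ ≤_) (∣⁅x⁆∣≡1 x) (p⊆q⇒∣p∣≤∣q∣ p⊆⁅x⁆)))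
  where
  p⊆⁅x⁆ : p ⊆ ⁅ x ⁆
  p⊆⁅x⁆ z∈p with x∈⁅y⁆∪⁅z⁆⁻ (p⊆ z∈p)
  ... | inj₁ refl = x∈⁅x⁆ x
  ... | inj₂ refl = ⊥-elim (y∉p z∈p)

∣p∣≤1⇒p⊆⁅y⁆⊎p⊆⁅x⁆ : ∀ {n} (y : Fin n) p → ∣ p ∣ ≤ 1 →
                      p ⊆ ⁅ y ⁆ ⊎ ∃ λ x → x ≢ y × x ∈ p × p ⊆ ⁅ x ⁆
∣p∣≤1⇒p⊆⁅y⁆⊎p⊆⁅x⁆ y p ∣p∣≤1 with nonempty? p
... | no empty      = inj₁ λ {x} x∈p → ⊥-elim (empty (x , x∈p))
... | yes (x , x∈p) with x F.≟ y
...   | yes refl = inj₁ (∣p∣≤1⇒p⊆⁅x⁆ p x∈p ∣p∣≤1)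
...   | no x≢y   = inj₂ (x , x≢y , x∈p , ∣p∣≤1⇒p⊆⁅x⁆ p x∈p ∣p∣≤1)

∣p∣≤1⇒∃p⊆⁅x⁆ : ∀ {n} → Fin n → ∀ (p : Subset n) → ∣ p ∣ ≤ 1 → ∃ λ x → p ⊆ ⁅ x ⁆
∣p∣≤1⇒∃p⊆⁅x⁆ y p ∣p∣≤1 with ∣p∣≤1⇒p⊆⁅y⁆⊎p⊆⁅x⁆ y p ∣p∣≤1
... | inj₁ p⊆⁅y⁆             = y , p⊆⁅y⁆
... | inj₂ (x , _ , _ , p⊆⁅x⁆) = x , p⊆⁅x⁆

↑E : ∀ {n} → Fin n → Fin (suc (suc n))
↑E j = inject₁ (inject₁ j)

↑z : ∀ {n} → Fin (suc (suc n))
↑z {n} = inject₁ (fromℕ n)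

↑γ : ∀ {n} → Fin (suc (suc n))
↑γ {n} = fromℕ (suc n)

data ExtendedIndex {n} : Fin (suc (suc n)) → Set where
  at-E : ∀ j → ExtendedIndex (↑E j)
  at-z : ExtendedIndex ↑z
  at-γ : ExtendedIndex ↑γ

inject₁-or-last : ∀ {m} (i : Fin (suc m)) → (∃ λ i₀ → i ≡ inject₁ i₀) ⊎ i ≡ fromℕ m
inject₁-or-last {zero}  fz     = inj₂ refl
inject₁-or-last {suc m} fz     = inj₁ (fz , refl)
inject₁-or-last {suc m} (fs i) with inject₁-or-last i
... | inj₁ (i₀ , refl) = inj₁ (fs i₀ , refl)
... | inj₂ refl        = inj₂ refl

extendedIndex : ∀ {n} (j : Fin (suc (suc n))) → ExtendedIndex j
extendedIndex j with inject₁-or-last j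
... | inj₂ refl = at-γ
... | inj₁ (j₁ , refl) with inject₁-or-last j₁
...   | inj₂ refl        = at-z
...   | inj₁ (j₀ , refl) = at-E j₀

bit : Bool → ℕ
bit true  = 1
bit false = 0

_⁺⟨_,_⟩ : ∀ {n} → Subset n → Bool → Bool → Subset (suc (suc n))
[]      ⁺⟨ hasz , hasγ ⟩ = hasz ∷ hasγ ∷ []
(b ∷ K) ⁺⟨ hasz , hasγ ⟩ = b ∷ K ⁺⟨ hasz , hasγ ⟩

↑E∈⁻ : ∀ {n} (K : Subset n) hasz hasγ {j} → ↑E j ∈ K ⁺⟨ hasz , hasγ ⟩ → j ∈ K
↑E∈⁻ (_ ∷ K) hasz hasγ {fz}   here       = here
↑E∈⁻ (_ ∷ K) hasz hasγ {fs j} (there j∈) = there (↑E∈⁻ K hasz hasγ j∈)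

↑E∈⁺ : ∀ {n} (K : Subset n) hasz hasγ {j} → j ∈ K → ↑E j ∈ K ⁺⟨ hasz , hasγ ⟩
↑E∈⁺ (_ ∷ K) hasz hasγ here        = here
↑E∈⁺ (_ ∷ K) hasz hasγ (there j∈K) = there (↑E∈⁺ K hasz hasγ j∈K)

↑z∈⁻ : ∀ {n} (K : Subset n) hasz hasγ → ↑z ∈ K ⁺⟨ hasz , hasγ ⟩ → hasz ≡ true
↑z∈⁻ []      hasz hasγ here       = refl
↑z∈⁻ (_ ∷ K) hasz hasγ (there z∈) = ↑z∈⁻ K hasz hasγ z∈

↑γ∈⁻ : ∀ {n} (K : Subset n) hasz hasγ → ↑γ ∈ K ⁺⟨ hasz , hasγ ⟩ → hasγ ≡ true
↑γ∈⁻ []      hasz hasγ (there here) = refl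
↑γ∈⁻ (_ ∷ K) hasz hasγ (there γ∈)   = ↑γ∈⁻ K hasz hasγ γ∈

∣K⁺∣ : ∀ {n} (K : Subset n) hasz hasγ → ∣ K ⁺⟨ hasz , hasγ ⟩ ∣ ≡ ∣ K ∣ + (bit hasz + bit hasγ)
∣K⁺∣ []          true  true  = refl
∣K⁺∣ []          true  false = refl
∣K⁺∣ []          false true  = refl
∣K⁺∣ []          false false = refl
∣K⁺∣ (true ∷ K)  hasz  hasγ  = cong suc (∣K⁺∣ K hasz hasγ)
∣K⁺∣ (false ∷ K) hasz  hasγ  = ∣K⁺∣ K hasz hasγ

↑z∈⁺ : ∀ {n} (K : Subset n) hasγ → ↑z ∈ K ⁺⟨ true , hasγ ⟩
↑z∈⁺ []      hasγ = here
↑z∈⁺ (_ ∷ K) hasγ = there (↑z∈⁺ K hasγ)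

↑γ∈⁺ : ∀ {n} (K : Subset n) hasz → ↑γ ∈ K ⁺⟨ hasz , true ⟩
↑γ∈⁺ []      hasz = there here
↑γ∈⁺ (_ ∷ K) hasz = there (↑γ∈⁺ K hasz)

_⇒ᵇ_ : Bool → Bool → Set
b ⇒ᵇ c = b ≡ true → c ≡ true

⁺-mono : ∀ {n} {K L : Subset n} {z z′ γ γ′} → K ⊆ L → z ⇒ᵇ z′ → γ ⇒ᵇ γ′ →
         K ⁺⟨ z , γ ⟩ ⊆ L ⁺⟨ z′ , γ′ ⟩
⁺-mono {K = K} {L} {z} {z′} {γ} {γ′} K⊆L z⇒z′ γ⇒γ′ {j} j∈ with extendedIndex j
... | at-E j₀ = ↑E∈⁺ L z′ γ′ (K⊆L (↑E∈⁻ K z γ j∈))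
... | at-z    = subst (λ b → ↑z ∈ L ⁺⟨ b , γ′ ⟩) (sym (z⇒z′ (↑z∈⁻ K z γ j∈))) (↑z∈⁺ L γ′)
... | at-γ    = subst (λ b → ↑γ ∈ L ⁺⟨ z′ , b ⟩) (sym (γ⇒γ′ (↑γ∈⁻ K z γ j∈))) (↑γ∈⁺ L z′)

onE : ∀ {n} → Subset (suc (suc n)) → Subset n
onE {zero}  (_ ∷ _ ∷ []) = []
onE {suc n} (b ∷ S)      = b ∷ onE S

z∈? : ∀ {n} → Subset (suc (suc n)) → Bool
z∈? {zero}  (b ∷ _ ∷ []) = b
z∈? {suc n} (_ ∷ S)      = z∈? S

γ∈? : ∀ {n} → Subset (suc (suc n)) → Bool
γ∈? {zero}  (_ ∷ b ∷ []) = b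
γ∈? {suc n} (_ ∷ S)      = γ∈? S

onE⁺ : ∀ {n} (S : Subset (suc (suc n))) → onE S ⁺⟨ z∈? S , γ∈? S ⟩ ≡ S
onE⁺ {zero}  (_ ∷ _ ∷ []) = refl
onE⁺ {suc n} (b ∷ S)      = cong (b ∷_) (onE⁺ S)

∁-⁺ : ∀ {n} (K : Subset n) hasz hasγ → ∁ (K ⁺⟨ hasz , hasγ ⟩) ≡ ∁ K ⁺⟨ not hasz , not hasγ ⟩
∁-⁺ []      hasz hasγ = refl
∁-⁺ (b ∷ K) hasz hasγ = cong (not b ∷_) (∁-⁺ K hasz hasγ)

↑z∉⁻ : ∀ {n} (K : Subset n) hasz hasγ → ↑z ∉ K ⁺⟨ hasz , hasγ ⟩ → hasz ≡ false
↑z∉⁻ K true  hasγ z∉ = ⊥-elim (z∉ (↑z∈⁺ K hasγ))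
↑z∉⁻ K false hasγ z∉ = refl

↑γ∉⁻ : ∀ {n} (K : Subset n) hasz hasγ → ↑γ ∉ K ⁺⟨ hasz , hasγ ⟩ → hasγ ≡ false
↑γ∉⁻ K hasz true  γ∉ = ⊥-elim (γ∉ (↑γ∈⁺ K hasz))
↑γ∉⁻ K hasz false γ∉ = refl

caseLast-inject₁ : ∀ {n} {B : Set} (f : Fin n → B) b i → caseLast f b (inject₁ i) ≡ f i
caseLast-inject₁ {suc zero}    f b fz     = refl
caseLast-inject₁ {suc (suc n)} f b fz     = refl
caseLast-inject₁ {suc (suc n)} f b (fs i) = caseLast-inject₁ (f ∘ fs) b i

caseLast-fromℕ : ∀ {n} {B : Set} (f : Fin n → B) b → caseLast f b (fromℕ n) ≡ b
caseLast-fromℕ {zero}  f b = refl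
caseLast-fromℕ {suc n} f b = caseLast-fromℕ (f ∘ fs) b

module ExtraRow (p : ℕ) .{{_ : NonZero p}} (pr : Prime p) {m n : ℕ}
                (B : Matrix p m n) (y : Fin n → GF p) where
  open GFp p
  open Sums p
  open VectorMatroid p B using (independent-or-dependence)

  IndependentWithRow : Subset n → Set
  IndependentWithRow K =
    ∀ d → (∀ j → j ∉ K → d j ≡ 𝟘) → (∀ i → d · B i ≡ 𝟘) → d · y ≡ 𝟘 → ∀ j → d j ≡ 𝟘

  -- If c is a dependence of K in M[B], then c · y ≢ 𝟘, and for a dependence d of K − j₀
  -- the combination (d · y) c − (c · y) d also kills y, hence vanishes; so K − j₀ is independent.
  independentWithRow-size : ∀ r → (∀ I → Independent p B I → ∣ I ∣ ≤ r) →
                            ∀ K → IndependentWithRow K → ∣ K ∣ ≤ suc r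
  independentWithRow-size r bound K ind with independent-or-dependence K
  ... | inj₁ indB = ℕₚ.m≤n⇒m≤1+n (bound K indB)
  ... | inj₂ (c , supp , rows , j₀ , c-j₀≢𝟘) =
    subst (_≤ suc r) (sym (∣p∣≡1+∣p-x∣ K j₀ j₀∈K)) (s≤s (bound (K - j₀) ind-K-j₀))
    where
    t : GF p
    t = c · y
    t≢𝟘 : t ≢ 𝟘
    t≢𝟘 t≡𝟘 = c-j₀≢𝟘 (ind c supp rows t≡𝟘 j₀)
    j₀∈K : j₀ ∈ K
    j₀∈K with j₀ ∈? K
    ... | yes j₀∈K = j₀∈K
    ... | no j₀∉K  = ⊥-elim (c-j₀≢𝟘 (supp j₀ j₀∉K))
    ind-K-j₀ : Independent p B (K - j₀)
    ind-K-j₀ d supp-d rows-d = d≡𝟘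
      where
      t′ : GF p
      t′ = d · y
      h : Fin n → GF p
      h j = t′ ⊗ c j ⊕ ⊖ t ⊗ d j
      h· : ∀ w → h · w ≡ t′ ⊗ (c · w) ⊕ ⊖ t ⊗ (d · w)
      h· w = trans (·-⊕ (λ j → t′ ⊗ c j) (λ j → ⊖ t ⊗ d j) w) (cong₂ _⊕_ (·-⊗ t′ c w) (·-⊗ (⊖ t) d w))
      both-𝟘 : ∀ {u v} → u ≡ 𝟘 → v ≡ 𝟘 → t′ ⊗ u ⊕ ⊖ t ⊗ v ≡ 𝟘
      both-𝟘 refl refl = trans (cong₂ _⊕_ (⊗-zeroʳ t′) (⊗-zeroʳ (⊖ t))) (⊕-identityˡ 𝟘)
      h≡𝟘 : ∀ j → h j ≡ 𝟘
      h≡𝟘 = ind h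
        (λ j j∉K → both-𝟘 (supp j j∉K) (supp-d j (j∉K ∘ p─q⊆p K ⁅ j₀ ⁆)))
        (λ i → trans (h· (B i)) (both-𝟘 (rows i) (rows-d i)))
        (trans (h· y) (x⊗y⊖y⊗x≡𝟘 t′ t))
      t′≡𝟘 : t′ ≡ 𝟘
      t′≡𝟘 = y≢𝟘∧x⊗y≡𝟘⇒x≡𝟘 pr t′ (c j₀) c-j₀≢𝟘 (begin
        t′ ⊗ c j₀      ≡⟨ sym (⊕-identityʳ _) ⟩
        t′ ⊗ c j₀ ⊕ 𝟘  ≡⟨ cong (t′ ⊗ c j₀ ⊕_) (sym (trans (cong (⊖ t ⊗_) d-j₀) (⊗-zeroʳ (⊖ t)))) ⟩
        h j₀           ≡⟨ h≡𝟘 j₀ ⟩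
        𝟘              ∎)
        where
        open ≡-Reasoning
        d-j₀ : d j₀ ≡ 𝟘
        d-j₀ = supp-d j₀ (λ j₀∈ → x∈p-y⇒x≢y K j₀ j₀∈ refl)
      d≡𝟘 : ∀ j → d j ≡ 𝟘
      d≡𝟘 j = x≢𝟘∧x⊗y≡𝟘⇒y≡𝟘 pr (⊖ t) (d j) (t≢𝟘 ∘ ⊖x≡𝟘⇒x≡𝟘 t) (begin
        ⊖ t ⊗ d j      ≡⟨ sym (⊕-identityˡ _) ⟩
        𝟘 ⊕ ⊖ t ⊗ d j  ≡⟨ cong (_⊕ ⊖ t ⊗ d j) (sym (trans (cong (_⊗ c j) t′≡𝟘) (⊗-zeroˡ (c j)))) ⟩
        h j            ≡⟨ h≡𝟘 j ⟩
        𝟘              ∎)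
        where open ≡-Reasoning

module Splitting (p : ℕ) .{{_ : NonZero p}} (pr : Prime p) {m n : ℕ} (A : Matrix p m n)
                 (a b : Fin n) (a≢b : a ≢ b) (α : GF p) (α≢𝟘 : α ≢ 0F p)
                 (e : Fin n) (e∈ab : e ≡ a ⊎ e ≡ b) where
  open GFp p
  open Sums p

  A₂ : Matrix p (suc m) (suc (suc n))
  A₂ = Aᵉ p A a b α e

  ρ : Fin n → GF p
  ρ j = if does (j F.≟ a) ∨ does (j F.≟ b) then α else 0F p

  f : Fin n
  f = [ (λ _ → b) , (λ _ → a) ]′ e∈ab

  f≢e : f ≢ e
  f≢e = go e∈ab
    where
    go : (e∈ : e ≡ a ⊎ e ≡ b) → [ (λ _ → b) , (λ _ → a) ]′ e∈ ≢ e
    go (inj₁ e≡a) b≡e = a≢b (sym (trans b≡e e≡a))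
    go (inj₂ e≡b) a≡e = a≢b (trans a≡e e≡b)

  ρ-a : ρ a ≡ α
  ρ-a with a F.≟ a
  ... | yes _  = refl
  ... | no a≢a = ⊥-elim (a≢a refl)

  ρ-b : ρ b ≡ α
  ρ-b with b F.≟ a | b F.≟ b
  ... | yes _ | _      = refl
  ... | no _  | yes _  = refl
  ... | no _  | no b≢b = ⊥-elim (b≢b refl)

  ρ-other : ∀ j → j ≢ a → j ≢ b → ρ j ≡ 𝟘
  ρ-other j j≢a j≢b with j F.≟ a | j F.≟ b
  ... | yes j≡a | _       = ⊥-elim (j≢a j≡a)
  ... | no _    | yes j≡b = ⊥-elim (j≢b j≡b)
  ... | no _    | no _    = refl

  ρ-e : ρ e ≡ α
  ρ-e = [ (λ e≡a → trans (cong ρ e≡a) ρ-a) , (λ e≡b → trans (cong ρ e≡b) ρ-b) ]′ e∈ab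

  ρ-f : ρ f ≡ α
  ρ-f = go e∈ab
    where
    go : (e∈ : e ≡ a ⊎ e ≡ b) → ρ ([ (λ _ → b) , (λ _ → a) ]′ e∈) ≡ α
    go (inj₁ _) = ρ-b
    go (inj₂ _) = ρ-a

  ρ-off-ef : ∀ j → j ≢ e → j ≢ f → ρ j ≡ 𝟘
  ρ-off-ef j = go e∈ab
    where
    go : (e∈ : e ≡ a ⊎ e ≡ b) → j ≢ e → j ≢ [ (λ _ → b) , (λ _ → a) ]′ e∈ → ρ j ≡ 𝟘
    go (inj₁ e≡a) j≢e j≢b = ρ-other j (λ j≡a → j≢e (trans j≡a (sym e≡a))) j≢b
    go (inj₂ e≡b) j≢e j≢a = ρ-other j j≢a (λ j≡b → j≢e (trans j≡b (sym e≡b)))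

  A′-top : ∀ i j → A′ p A a b α (inject₁ i) (inject₁ j) ≡ A i j
  A′-top i j = trans (caseLast-inject₁ _ _ i) (caseLast-inject₁ (A i) (0F p) j)

  A′-top-z : ∀ i → A′ p A a b α (inject₁ i) (fromℕ n) ≡ 𝟘
  A′-top-z i = trans (caseLast-inject₁ _ _ i) (caseLast-fromℕ (A i) (0F p))

  A′-last : ∀ j → A′ p A a b α (fromℕ m) (inject₁ j) ≡ ρ j
  A′-last j = trans (caseLast-fromℕ {m} _ _) (caseLast-inject₁ ρ α j)

  A′-last-z : A′ p A a b α (fromℕ m) (fromℕ n) ≡ α
  A′-last-z = trans (caseLast-fromℕ {m} _ _) (caseLast-fromℕ ρ α)

  ·-extended : ∀ (c w : Fin (suc (suc n)) → GF p) →
               c · w ≡ (c ∘ ↑E) · (w ∘ ↑E) ⊕ c ↑z ⊗ w ↑z ⊕ c ↑γ ⊗ w ↑γ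
  ·-extended c w = trans (ΣF-last (λ j → c j ⊗ w j))
    (cong (_⊕ c ↑γ ⊗ w ↑γ) (ΣF-last (λ j → c (inject₁ j) ⊗ w (inject₁ j))))

  -- In the rows of A the column γ repeats e; in the new row it is ρ e − α = 𝟘.
  ·-top-row : ∀ c i → c · A₂ (inject₁ i) ≡ (c ∘ ↑E) · A i ⊕ c ↑γ ⊗ A i e
  ·-top-row c i = begin
    c · A₂ (inject₁ i)
      ≡⟨ ·-extended c (A₂ (inject₁ i)) ⟩
    (c ∘ ↑E) · (A₂ (inject₁ i) ∘ ↑E) ⊕ c ↑z ⊗ A₂ (inject₁ i) ↑z ⊕ c ↑γ ⊗ A₂ (inject₁ i) ↑γ
      ≡⟨ cong₂ (λ u v → u ⊕ c ↑γ ⊗ v) (cong₂ _⊕_ (·-congʳ (c ∘ ↑E) entry-E) (cong (c ↑z ⊗_) entry-z))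
               entry-γ ⟩
    (c ∘ ↑E) · A i ⊕ c ↑z ⊗ 𝟘 ⊕ c ↑γ ⊗ A i e
      ≡⟨ cong (λ u → (c ∘ ↑E) · A i ⊕ u ⊕ c ↑γ ⊗ A i e) (⊗-zeroʳ (c ↑z)) ⟩
    (c ∘ ↑E) · A i ⊕ 𝟘 ⊕ c ↑γ ⊗ A i e
      ≡⟨ cong (_⊕ c ↑γ ⊗ A i e) (⊕-identityʳ _) ⟩
    (c ∘ ↑E) · A i ⊕ c ↑γ ⊗ A i e ∎
    where
    open ≡-Reasoning
    entry-E : ∀ j → A₂ (inject₁ i) (↑E j) ≡ A i j
    entry-E j = trans (caseLast-inject₁ _ _ (inject₁ j)) (A′-top i j)
    entry-z : A₂ (inject₁ i) ↑z ≡ 𝟘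
    entry-z = trans (caseLast-inject₁ _ _ (fromℕ n)) (A′-top-z i)
    entry-γ : A₂ (inject₁ i) ↑γ ≡ A i e
    entry-γ = trans (caseLast-fromℕ (A′ p A a b α (inject₁ i)) _)
      (trans (cong₂ (λ u v → u ⊕ ⊖ v) (A′-top i e) (A′-top-z i)) (x⊖𝟘≡x (A i e)))

  ·-last-row : ∀ c → c · A₂ (fromℕ m) ≡ (c ∘ ↑E) · ρ ⊕ c ↑z ⊗ α
  ·-last-row c = begin
    c · A₂ (fromℕ m)
      ≡⟨ ·-extended c (A₂ (fromℕ m)) ⟩
    (c ∘ ↑E) · (A₂ (fromℕ m) ∘ ↑E) ⊕ c ↑z ⊗ A₂ (fromℕ m) ↑z ⊕ c ↑γ ⊗ A₂ (fromℕ m) ↑γ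
      ≡⟨ cong₂ (λ u v → u ⊕ c ↑γ ⊗ v) (cong₂ _⊕_ (·-congʳ (c ∘ ↑E) entry-E) (cong (c ↑z ⊗_) entry-z))
               entry-γ ⟩
    (c ∘ ↑E) · ρ ⊕ c ↑z ⊗ α ⊕ c ↑γ ⊗ 𝟘
      ≡⟨ trans (cong ((c ∘ ↑E) · ρ ⊕ c ↑z ⊗ α ⊕_) (⊗-zeroʳ (c ↑γ))) (⊕-identityʳ _) ⟩
    (c ∘ ↑E) · ρ ⊕ c ↑z ⊗ α ∎
    where
    open ≡-Reasoning
    entry-E : ∀ j → A₂ (fromℕ m) (↑E j) ≡ ρ j
    entry-E j = trans (caseLast-inject₁ _ _ (inject₁ j)) (A′-last j)
    entry-z : A₂ (fromℕ m) ↑z ≡ α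
    entry-z = trans (caseLast-inject₁ _ _ (fromℕ n)) A′-last-z
    entry-γ : A₂ (fromℕ m) ↑γ ≡ 𝟘
    entry-γ = trans (caseLast-fromℕ (A′ p A a b α (fromℕ m)) _)
      (trans (cong₂ (λ u v → u ⊕ ⊖ v) (A′-last e) A′-last-z) (trans (cong (_⊕ ⊖ α) ρ-e) (⊖-inverseʳ α)))

  -- Independence of K ∪ {z if hasz} ∪ {γ if hasγ} in M[A₂], written through the blocks of A₂.
  SplitIndependent : Subset n → Bool → Bool → Set
  SplitIndependent K hasz hasγ =
    ∀ (c : Fin n → GF p) cz cγ → (∀ j → j ∉ K → c j ≡ 𝟘) →
    (hasz ≡ false → cz ≡ 𝟘) → (hasγ ≡ false → cγ ≡ 𝟘) →
    (∀ i → c · A i ⊕ cγ ⊗ A i e ≡ 𝟘) → c · ρ ⊕ cz ⊗ α ≡ 𝟘 →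
    (∀ j → c j ≡ 𝟘) × cz ≡ 𝟘 × cγ ≡ 𝟘

  splitIndependent⇒independent : ∀ K hasz hasγ → SplitIndependent K hasz hasγ →
                                 Independent p A₂ (K ⁺⟨ hasz , hasγ ⟩)
  splitIndependent⇒independent K hasz hasγ ind c supp rows j
    with ind (c ∘ ↑E) (c ↑z) (c ↑γ)
           (λ j j∉K → supp (↑E j) (j∉K ∘ ↑E∈⁻ K hasz hasγ))
           (λ hasz≡false → supp ↑z (λ z∈ → case trans (sym (↑z∈⁻ K hasz hasγ z∈)) hasz≡false of λ ()))
           (λ hasγ≡false → supp ↑γ (λ γ∈ → case trans (sym (↑γ∈⁻ K hasz hasγ γ∈)) hasγ≡false of λ ()))
           (λ i → trans (sym (·-top-row c i)) (rows (inject₁ i)))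
           (trans (sym (·-last-row c)) (rows (fromℕ m)))
  ... | c≡𝟘 , cz≡𝟘 , cγ≡𝟘 with extendedIndex j
  ...   | at-E j₀ = c≡𝟘 j₀
  ...   | at-z    = cz≡𝟘
  ...   | at-γ    = cγ≡𝟘

  _⁺[_,_] : (Fin n → GF p) → GF p → GF p → Fin (suc (suc n)) → GF p
  c ⁺[ cz , cγ ] = caseLast (caseLast c cz) cγ

  ⁺[]-E : ∀ c cz cγ j → (c ⁺[ cz , cγ ]) (↑E j) ≡ c j
  ⁺[]-E c cz cγ j = trans (caseLast-inject₁ (caseLast c cz) cγ (inject₁ j)) (caseLast-inject₁ c cz j)

  ⁺[]-z : ∀ c cz cγ → (c ⁺[ cz , cγ ]) ↑z ≡ cz
  ⁺[]-z c cz cγ = trans (caseLast-inject₁ (caseLast c cz) cγ (fromℕ n)) (caseLast-fromℕ c cz)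

  ⁺[]-γ : ∀ c cz cγ → (c ⁺[ cz , cγ ]) ↑γ ≡ cγ
  ⁺[]-γ c cz cγ = caseLast-fromℕ (caseLast c cz) cγ

  independent⇒splitIndependent : ∀ K hasz hasγ → Independent p A₂ (K ⁺⟨ hasz , hasγ ⟩) →
                                 SplitIndependent K hasz hasγ
  independent⇒splitIndependent K hasz hasγ ind c cz cγ supp z-supp γ-supp rows last =
    (λ j → trans (sym (⁺[]-E c cz cγ j)) (ind c′ supp′ rows′ (↑E j))) ,
    trans (sym (⁺[]-z c cz cγ)) (ind c′ supp′ rows′ ↑z) ,
    trans (sym (⁺[]-γ c cz cγ)) (ind c′ supp′ rows′ ↑γ)
    where
    c′ : Fin (suc (suc n)) → GF p
    c′ = c ⁺[ cz , cγ ]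
    supp′ : ∀ j → j ∉ K ⁺⟨ hasz , hasγ ⟩ → c′ j ≡ 𝟘
    supp′ j j∉ with extendedIndex j
    ... | at-E j₀ = trans (⁺[]-E c cz cγ j₀) (supp j₀ (j∉ ∘ ↑E∈⁺ K hasz hasγ))
    ... | at-z    = trans (⁺[]-z c cz cγ) (z-supp (↑z∉⁻ K hasz hasγ j∉))
    ... | at-γ    = trans (⁺[]-γ c cz cγ) (γ-supp (↑γ∉⁻ K hasz hasγ j∉))
    rows′ : ∀ i → c′ · A₂ i ≡ 𝟘
    rows′ i with inject₁-or-last i
    ... | inj₁ (i₀ , refl) = trans (·-top-row c′ i₀)
      (trans (cong₂ (λ u v → u ⊕ v ⊗ A i₀ e) (·-congˡ (A i₀) (⁺[]-E c cz cγ)) (⁺[]-γ c cz cγ)) (rows i₀))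
    ... | inj₂ refl = trans (·-last-row c′)
      (trans (cong₂ (λ u v → u ⊕ v ⊗ α) (·-congˡ ρ (⁺[]-E c cz cγ)) (⁺[]-z c cz cγ)) last)

  independent⇒+z : ∀ K → Independent p A K → SplitIndependent K true false
  independent⇒+z K ind c cz cγ supp _ γ-supp rows last = c≡𝟘 , cz≡𝟘 , γ-supp refl
    where
    c≡𝟘 : ∀ j → c j ≡ 𝟘
    c≡𝟘 = ind c supp (λ i → x⊕y⊗z≡𝟘∧y≡𝟘⇒x≡𝟘 (A i e) (γ-supp refl) (rows i))
    cz≡𝟘 : cz ≡ 𝟘
    cz≡𝟘 = x⊕y⊗z≡𝟘∧x≡𝟘⇒y≡𝟘 pr α≢𝟘 (·-zero c ρ c≡𝟘) last

  -- ρ vanishes on I, so the new row alone forces the coefficient of w to be 𝟘.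
  independent⇒∪⁅e∨f⁆ : ∀ I w → Independent p A I → e ∉ I → f ∉ I → w ≡ e ⊎ w ≡ f →
                       SplitIndependent (I ∪ ⁅ w ⁆) false false
  independent⇒∪⁅e∨f⁆ I w ind e∉I f∉I w∈ef c cz cγ supp z-supp γ-supp rows last =
    c≡𝟘 , z-supp refl , γ-supp refl
    where
    c-off-I : ∀ j → j ∉ I → j ≢ w → c j ≡ 𝟘
    c-off-I j j∉I j≢w = supp j (λ j∈ → j≢w (x∉p⇒x∈p∪⁅y⁆⇒x≡y I w j∉I j∈))
    cρ-off-w : ∀ j → j ≢ w → c j ⊗ ρ j ≡ 𝟘
    cρ-off-w j j≢w with j F.≟ e | j F.≟ f
    ... | yes refl | _        = trans (cong (_⊗ ρ j) (c-off-I j e∉I j≢w)) (⊗-zeroˡ _)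
    ... | no _     | yes refl = trans (cong (_⊗ ρ j) (c-off-I j f∉I j≢w)) (⊗-zeroˡ _)
    ... | no j≢e   | no j≢f   = trans (cong (c j ⊗_) (ρ-off-ef j j≢e j≢f)) (⊗-zeroʳ (c j))
    ρ-w : ρ w ≡ α
    ρ-w = [ (λ w≡e → trans (cong ρ w≡e) ρ-e) , (λ w≡f → trans (cong ρ w≡f) ρ-f) ]′ w∈ef
    c-w : c w ≡ 𝟘
    c-w = y≢𝟘∧x⊗y≡𝟘⇒x≡𝟘 pr (c w) α α≢𝟘 (begin
      c w ⊗ α   ≡⟨ cong (c w ⊗_) (sym ρ-w) ⟩
      c w ⊗ ρ w ≡⟨ sym (·-single c ρ w cρ-off-w) ⟩
      c · ρ     ≡⟨ x⊕y⊗z≡𝟘∧y≡𝟘⇒x≡𝟘 α (z-supp refl) last ⟩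
      𝟘         ∎)
      where open ≡-Reasoning
    c≡𝟘 : ∀ j → c j ≡ 𝟘
    c≡𝟘 = ind c (λ j j∉I → case j F.≟ w of λ where
                   (yes refl) → c-w
                   (no j≢w)   → c-off-I j j∉I j≢w)
              (λ i → x⊕y⊗z≡𝟘∧y≡𝟘⇒x≡𝟘 (A i e) (γ-supp refl) (rows i))

  relation-through-γ : ∀ I → Independent p A I → e ∈ I → ∀ c cγ → (∀ j → j ∉ I → c j ≡ 𝟘) →
                       (∀ i → c · A i ⊕ cγ ⊗ A i e ≡ 𝟘) → (∀ j → j ≢ e → c j ≡ 𝟘) × c e ⊕ cγ ≡ 𝟘
  relation-through-γ I ind e∈I c cγ supp rows =
    (λ j j≢e → trans (sym (⊕-identityʳ _)) (trans (cong (c j ⊕_) (sym (δ-other e cγ j j≢e))) (moved≡𝟘 j))) ,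
    trans (cong (c e ⊕_) (sym (δ-same e cγ))) (moved≡𝟘 e)
    where
    moved≡𝟘 : ∀ j → c j ⊕ δ e cγ j ≡ 𝟘
    moved≡𝟘 = ind _
      (λ j j∉I → trans (cong₂ _⊕_ (supp j j∉I) (δ-other e cγ j (λ j≡e → j∉I (subst (_∈ I) (sym j≡e) e∈I))))
                       (⊕-identityˡ 𝟘))
      (λ i → trans (·-⊕ c (δ e cγ) (A i)) (trans (cong (c · A i ⊕_) (·-δ e cγ (A i))) (rows i)))

  independent∋e⇒+γ : ∀ K → Independent p A K → e ∈ K → SplitIndependent K false true
  independent∋e⇒+γ K ind e∈K c cz cγ supp z-supp _ rows last =
    zero-everywhere c e c-off-e c-e , z-supp refl , cγ≡𝟘
    where
    c-off-e : ∀ j → j ≢ e → c j ≡ 𝟘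
    c-off-e = proj₁ (relation-through-γ K ind e∈K c cγ supp rows)
    c-e : c e ≡ 𝟘
    c-e = y≢𝟘∧x⊗y≡𝟘⇒x≡𝟘 pr (c e) α α≢𝟘 (begin
      c e ⊗ α   ≡⟨ cong (c e ⊗_) (sym ρ-e) ⟩
      c e ⊗ ρ e ≡⟨ sym (·-single c ρ e (λ j j≢e → trans (cong (_⊗ ρ j) (c-off-e j j≢e)) (⊗-zeroˡ _))) ⟩
      c · ρ     ≡⟨ x⊕y⊗z≡𝟘∧y≡𝟘⇒x≡𝟘 α (z-supp refl) last ⟩
      𝟘         ∎)
      where open ≡-Reasoning
    cγ≡𝟘 : cγ ≡ 𝟘
    cγ≡𝟘 = trans (sym (⊕-identityˡ cγ))
      (trans (cong (_⊕ cγ) (sym c-e)) (proj₂ (relation-through-γ K ind e∈K c cγ supp rows)))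

  independent∋e⇒-e+zγ : ∀ I K hasz → Independent p A I → e ∈ I → K ⊆ I → e ∉ K →
                        SplitIndependent K hasz true
  independent∋e⇒-e+zγ I K hasz ind e∈I K⊆I e∉K c cz cγ supp _ _ rows last =
    c≡𝟘 , x⊕y⊗z≡𝟘∧x≡𝟘⇒y≡𝟘 pr α≢𝟘 (·-zero c ρ c≡𝟘) last , cγ≡𝟘
    where
    relation : (∀ j → j ≢ e → c j ≡ 𝟘) × c e ⊕ cγ ≡ 𝟘
    relation = relation-through-γ I ind e∈I c cγ (λ j j∉I → supp j (j∉I ∘ K⊆I)) rows
    c≡𝟘 : ∀ j → c j ≡ 𝟘
    c≡𝟘 = zero-everywhere c e (proj₁ relation) (supp e e∉K)
    cγ≡𝟘 : cγ ≡ 𝟘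
    cγ≡𝟘 = trans (sym (⊕-identityˡ cγ)) (trans (cong (_⊕ cγ) (sym (c≡𝟘 e))) (proj₂ relation))

  splitIndependent-without-z : ∀ K hasγ → SplitIndependent K true hasγ → SplitIndependent K false hasγ
  splitIndependent-without-z K hasγ ind c cz cγ supp _ = ind c cz cγ supp (λ ())

  module SizeBound (r : ℕ) (bound : ∀ I → Independent p A I → ∣ I ∣ ≤ r) where

    ∣K∣+1≤1+r : ∀ {K : Subset n} → ∣ K ∣ ≤ r → ∣ K ∣ + 1 ≤ suc r
    ∣K∣+1≤1+r {K} ∣K∣≤r = subst (_≤ suc r) (ℕₚ.+-comm 1 ∣ K ∣) (s≤s ∣K∣≤r)

    independent-z : ∀ K hasγ → SplitIndependent K true hasγ → Independent p A K
    independent-z K hasγ ind d supp rows j = x≢𝟘∧x⊗y≡𝟘⇒y≡𝟘 pr α (d j) α≢𝟘 (proj₁ relation j)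
      where
      relation : (∀ j → α ⊗ d j ≡ 𝟘) × ⊖ (d · ρ) ≡ 𝟘 × 𝟘 ≡ 𝟘
      relation = ind (λ j → α ⊗ d j) (⊖ (d · ρ)) 𝟘
        (λ j j∉K → trans (cong (α ⊗_) (supp j j∉K)) (⊗-zeroʳ α)) (λ ()) (λ _ → refl)
        (λ i → trans (x⊕𝟘⊗y≡x _ (A i e)) (trans (·-⊗ α d (A i)) (trans (cong (α ⊗_) (rows i)) (⊗-zeroʳ α))))
        (trans (cong (_⊕ ⊖ (d · ρ) ⊗ α) (·-⊗ α d ρ)) (x⊗y⊖y⊗x≡𝟘 α (d · ρ)))

    -- The columns satisfy e = z + γ.
    ¬independent-e+zγ : ∀ K → e ∈ K → ¬ SplitIndependent K true true
    ¬independent-e+zγ K e∈K ind = 𝟙≢𝟘 pr (trans (sym (δ-same e 𝟙)) (proj₁ relation e))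
      where
      relation : (∀ j → δ e 𝟙 j ≡ 𝟘) × ⊖ 𝟙 ≡ 𝟘 × ⊖ 𝟙 ≡ 𝟘
      relation = ind (δ e 𝟙) (⊖ 𝟙) (⊖ 𝟙)
        (λ j j∉K → δ-other e 𝟙 j (λ j≡e → j∉K (subst (_∈ K) (sym j≡e) e∈K))) (λ ()) (λ ())
        (λ i → trans (cong (_⊕ ⊖ 𝟙 ⊗ A i e) (·-δ e 𝟙 (A i))) (x⊗y⊖x⊗y≡𝟘 𝟙 (A i e)))
        (trans (cong (_⊕ ⊖ 𝟙 ⊗ α) (trans (·-δ e 𝟙 ρ) (cong (𝟙 ⊗_) ρ-e))) (x⊗y⊖x⊗y≡𝟘 𝟙 α))

    erase-outside : ∀ K d → (∀ j → j ∉ K ∪ ⁅ e ⁆ → d j ≡ 𝟘) → ∀ j → j ∉ K → erase e d j ≡ 𝟘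
    erase-outside K d supp j j∉K with j F.≟ e
    ... | yes _  = refl
    ... | no j≢e = supp j (λ j∈ → j≢e (x∉p⇒x∈p∪⁅y⁆⇒x≡y K e j∉K j∈))

    -- γ and z together play the role of e.
    independent-zγ : ∀ K → e ∉ K → SplitIndependent K true true → Independent p A (K ∪ ⁅ e ⁆)
    independent-zγ K e∉K ind d supp rows = zero-everywhere d e d-off-e d-e
      where
      t : GF p
      t = erase e d · ρ
      relation : (∀ j → α ⊗ erase e d j ≡ 𝟘) × ⊖ t ≡ 𝟘 × α ⊗ d e ≡ 𝟘
      relation = ind (λ j → α ⊗ erase e d j) (⊖ t) (α ⊗ d e)
        (λ j j∉K → trans (cong (α ⊗_) (erase-outside K d supp j j∉K)) (⊗-zeroʳ α)) (λ ()) (λ ())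
        (λ i → trans (cong₂ _⊕_ (·-⊗ α (erase e d) (A i)) (⊗-assoc α (d e) (A i e)))
          (trans (sym (⊗-distribˡ-⊕ α (erase e d · A i) (d e ⊗ A i e)))
          (trans (cong (α ⊗_) (trans (sym (·-erase e d (A i))) (rows i))) (⊗-zeroʳ α))))
        (trans (cong (_⊕ ⊖ t ⊗ α) (·-⊗ α (erase e d) ρ)) (x⊗y⊖y⊗x≡𝟘 α t))
      d-e : d e ≡ 𝟘
      d-e = x≢𝟘∧x⊗y≡𝟘⇒y≡𝟘 pr α (d e) α≢𝟘 (proj₂ (proj₂ relation))
      d-off-e : ∀ j → j ≢ e → d j ≡ 𝟘
      d-off-e j j≢e = trans (sym (erase-other e d j j≢e)) (x≢𝟘∧x⊗y≡𝟘⇒y≡𝟘 pr α _ α≢𝟘 (proj₁ relation j))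

    independent-γ : ∀ K → e ∈ K → SplitIndependent K false true → Independent p A K
    independent-γ K e∈K ind d supp rows j = x≢𝟘∧x⊗y≡𝟘⇒y≡𝟘 pr α (d j) α≢𝟘
      (trans (sym (⊕-identityʳ _)) (trans (cong (α ⊗ d j ⊕_) (sym δ-⊖t≡𝟘)) (proj₁ relation j)))
      where
      t : GF p
      t = d · ρ
      c : Fin n → GF p
      c j = α ⊗ d j ⊕ δ e (⊖ t) j
      c· : ∀ w → c · w ≡ α ⊗ (d · w) ⊕ ⊖ t ⊗ w e
      c· w = trans (·-⊕ (λ j → α ⊗ d j) (δ e (⊖ t)) w) (cong₂ _⊕_ (·-⊗ α d w) (·-δ e (⊖ t) w))
      relation : (∀ j → c j ≡ 𝟘) × 𝟘 ≡ 𝟘 × t ≡ 𝟘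
      relation = ind c 𝟘 t
        (λ j j∉K → trans (cong₂ _⊕_ (trans (cong (α ⊗_) (supp j j∉K)) (⊗-zeroʳ α))
                                    (δ-other e (⊖ t) j (λ j≡e → j∉K (subst (_∈ K) (sym j≡e) e∈K))))
                         (⊕-identityˡ 𝟘))
        (λ _ → refl) (λ ())
        (λ i → begin
          c · A i ⊕ t ⊗ A i e                       ≡⟨ cong (_⊕ t ⊗ A i e) (c· (A i)) ⟩
          α ⊗ (d · A i) ⊕ ⊖ t ⊗ A i e ⊕ t ⊗ A i e  ≡⟨ cong (λ u → α ⊗ u ⊕ ⊖ t ⊗ A i e ⊕ t ⊗ A i e) (rows i) ⟩
          α ⊗ 𝟘 ⊕ ⊖ t ⊗ A i e ⊕ t ⊗ A i e          ≡⟨ cong (λ u → u ⊕ ⊖ t ⊗ A i e ⊕ t ⊗ A i e) (⊗-zeroʳ α) ⟩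
          𝟘 ⊕ ⊖ t ⊗ A i e ⊕ t ⊗ A i e              ≡⟨ cong (_⊕ t ⊗ A i e) (⊕-identityˡ _) ⟩
          ⊖ t ⊗ A i e ⊕ t ⊗ A i e                  ≡⟨ ⊕-comm (⊖ t ⊗ A i e) (t ⊗ A i e) ⟩
          t ⊗ A i e ⊕ ⊖ t ⊗ A i e                  ≡⟨ x⊗y⊖x⊗y≡𝟘 t (A i e) ⟩
          𝟘                                        ∎)
        (trans (x⊕𝟘⊗y≡x _ α) (trans (c· ρ) (trans (cong (α ⊗ t ⊕_) (cong (⊖ t ⊗_) ρ-e)) (x⊗y⊖y⊗x≡𝟘 α t))))
        where open ≡-Reasoning
      δ-⊖t≡𝟘 : δ e (⊖ t) j ≡ 𝟘
      δ-⊖t≡𝟘 = trans (cong (λ u → δ e u j) (trans (cong ⊖ (proj₂ (proj₂ relation))) ⊖-𝟘)) (δ-𝟘 e j)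

    -- Without z, the column γ is the column of e with its new-row entry erased.
    independentWithRow-γ : ∀ K → e ∉ K → SplitIndependent K false true →
                           ExtraRow.IndependentWithRow p pr A (erase e ρ) (K ∪ ⁅ e ⁆)
    independentWithRow-γ K e∉K ind d supp rows last =
      zero-everywhere d e (λ j j≢e → trans (sym (erase-other e d j j≢e)) (proj₁ relation j))
                          (proj₂ (proj₂ relation))
      where
      relation : (∀ j → erase e d j ≡ 𝟘) × 𝟘 ≡ 𝟘 × d e ≡ 𝟘
      relation = ind (erase e d) 𝟘 (d e) (erase-outside K d supp) (λ _ → refl) (λ ())
        (λ i → trans (sym (·-erase e d (A i))) (rows i))
        (trans (x⊕𝟘⊗y≡x _ α) (trans (erase-swap e d ρ) last))

    size-bound : ∀ K hasz hasγ → SplitIndependent K hasz hasγ → ∣ K ∣ + (bit hasz + bit hasγ) ≤ suc r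
    size-bound K true false ind = ∣K∣+1≤1+r {K} (bound K (independent-z K false ind))
    size-bound K true true ind with e ∈? K
    ... | yes e∈K = ⊥-elim (¬independent-e+zγ K e∈K ind)
    ... | no e∉K  = subst (_≤ suc r) (trans (cong suc (∣p∪⁅x⁆∣≡1+∣p∣ K e e∉K)) (ℕₚ.+-comm 2 ∣ K ∣))
                      (s≤s (bound (K ∪ ⁅ e ⁆) (independent-zγ K e∉K ind)))
    size-bound K false true ind with e ∈? K
    ... | yes e∈K = ∣K∣+1≤1+r {K} (bound K (independent-γ K e∈K ind))
    ... | no e∉K  = subst (_≤ suc r) (trans (∣p∪⁅x⁆∣≡1+∣p∣ K e e∉K) (ℕₚ.+-comm 1 ∣ K ∣))
                      (ExtraRow.independentWithRow-size p pr A (erase e ρ) r bound (K ∪ ⁅ e ⁆)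
                        (independentWithRow-γ K e∉K ind))
    size-bound K false false ind = subst (_≤ suc r) (sym (ℕₚ.+-identityʳ ∣ K ∣))
      (ExtraRow.independentWithRow-size p pr A ρ r bound K
        (λ d supp rows last → proj₁ (ind d 𝟘 𝟘 supp (λ _ → refl) (λ _ → refl)
          (λ i → trans (x⊕𝟘⊗y≡x _ (A i e)) (rows i)) (trans (x⊕𝟘⊗y≡x _ α) last))))

  module Connectivity (tc : ThreeConnected p A) (n>4 : 4 < n) where
    open VectorMatroid p A using (rank)

    rk : Subset n → ℕ
    rk X = proj₁ (rank X)

    basis : Subset n → Subset n
    basis X = proj₁ (proj₁ (proj₂ (rank X)))

    basis⊆ : ∀ X → basis X ⊆ X
    basis⊆ X = proj₁ (proj₂ (proj₁ (proj₂ (rank X))))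

    basis-independent : ∀ X → Independent p A (basis X)
    basis-independent X = proj₁ (proj₂ (proj₂ (proj₁ (proj₂ (rank X)))))

    ∣basis∣ : ∀ X → ∣ basis X ∣ ≡ rk X
    ∣basis∣ X = proj₂ (proj₂ (proj₂ (proj₁ (proj₂ (rank X)))))

    rk-maximal : ∀ X I → I ⊆ X → Independent p A I → ∣ I ∣ ≤ rk X
    rk-maximal X = proj₂ (proj₂ (rank X))

    rk-mono : ∀ {X Y} → X ⊆ Y → rk X ≤ rk Y
    rk-mono {X} {Y} X⊆Y =
      subst (_≤ rk Y) (∣basis∣ X) (rk-maximal Y (basis X) (X⊆Y ∘ basis⊆ X) (basis-independent X))

    rk≤∣X∣ : ∀ X → rk X ≤ ∣ X ∣
    rk≤∣X∣ X = subst (_≤ ∣ X ∣) (∣basis∣ X) (p⊆q⇒∣p∣≤∣q∣ (basis⊆ X))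

    R : ℕ
    R = rk ⊤

    rank-sum : ∀ k X → 1 ≤ k → k ≤ 2 → k ≤ ∣ X ∣ → k ≤ ∣ ∁ X ∣ → k + R ≤ rk X + rk (∁ X)
    rank-sum k X 1≤k k≤2 k≤∣X∣ k≤∣∁X∣ with k + R ℕ.≤? rk X + rk (∁ X)
    ... | yes sum≥ = sum≥
    ... | no sum≱ = ⊥-elim (no-separation k 1≤k k≤2
          (k≤∣X∣ , k≤∣∁X∣ , rk X , rk (∁ X) , R , proj₂ (rank X) , proj₂ (rank (∁ X)) , proj₂ (rank ⊤) ,
           ℕₚ.≰⇒> sum≱))
      where
      no-separation : ∀ k → 1 ≤ k → k ≤ 2 → ¬ Separation p k A X
      no-separation 1 _ _ = proj₁ (tc X)
      no-separation 2 _ _ = proj₂ (tc X)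
      no-separation (suc (suc (suc _))) _ (s≤s (s≤s ()))

    small-side : ∀ k X → 1 ≤ k → k ≤ 2 → ∣ X ∣ ≡ k → k ≤ rk X × R ≤ rk (∁ X)
    small-side k X 1≤k k≤2 ∣X∣≡k =
      ℕₚ.+-cancelʳ-≤ R k (rk X) (ℕₚ.≤-trans sum (ℕₚ.+-monoʳ-≤ (rk X) (rk-mono {∁ X} (λ _ → ∈⊤)))) ,
      ℕₚ.+-cancelˡ-≤ k R (rk (∁ X))
        (ℕₚ.≤-trans sum (ℕₚ.+-monoˡ-≤ (rk (∁ X)) (subst (rk X ≤_) ∣X∣≡k (rk≤∣X∣ X))))
      where
      3≤∣∁X∣ : 3 ≤ ∣ ∁ X ∣
      3≤∣∁X∣ = ℕₚ.+-cancelʳ-≤ k 3 ∣ ∁ X ∣ (ℕₚ.≤-trans (ℕₚ.+-monoʳ-≤ 3 k≤2)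
                 (ℕₚ.≤-trans n>4 (ℕₚ.≤-reflexive (sym (trans (cong (∣ ∁ X ∣ +_) (sym ∣X∣≡k)) (∣∁p∣+∣p∣≡n X))))))
      sum : k + R ≤ rk X + rk (∁ X)
      sum = rank-sum k X 1≤k k≤2 (ℕₚ.≤-reflexive (sym ∣X∣≡k)) (ℕₚ.≤-trans k≤2 (ℕₚ.≤-trans (ℕₚ.n≤1+n 2) 3≤∣∁X∣))

    1≤rk⁅x⁆ : ∀ x → 1 ≤ rk ⁅ x ⁆
    1≤rk⁅x⁆ x = proj₁ (small-side 1 ⁅ x ⁆ ℕₚ.≤-refl (s≤s z≤n) (∣⁅x⁆∣≡1 x))

    2≤rk⁅x⁆∪⁅y⁆ : ∀ x y → x ≢ y → 2 ≤ rk (⁅ x ⁆ ∪ ⁅ y ⁆)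
    2≤rk⁅x⁆∪⁅y⁆ x y x≢y = proj₁ (small-side 2 (⁅ x ⁆ ∪ ⁅ y ⁆) (s≤s z≤n) ℕₚ.≤-refl (∣⁅x⁆∪⁅y⁆∣≡2 x y x≢y))

    R≤rk∁⁅x⁆ : ∀ x → R ≤ rk (∁ ⁅ x ⁆)
    R≤rk∁⁅x⁆ x = proj₂ (small-side 1 ⁅ x ⁆ ℕₚ.≤-refl (s≤s z≤n) (∣⁅x⁆∣≡1 x))

    R≤rk∁⁅x⁆∪⁅y⁆ : ∀ x y → R ≤ rk (∁ (⁅ x ⁆ ∪ ⁅ y ⁆))
    R≤rk∁⁅x⁆∪⁅y⁆ x y with x F.≟ y
    ... | yes refl = subst (λ X → R ≤ rk (∁ X)) (sym (∪-idem ⁅ x ⁆)) (R≤rk∁⁅x⁆ x)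
    ... | no x≢y   = proj₂ (small-side 2 (⁅ x ⁆ ∪ ⁅ y ⁆) (s≤s z≤n) ℕₚ.≤-refl (∣⁅x⁆∪⁅y⁆∣≡2 x y x≢y))

    RankBound : Subset (suc (suc n)) → ℕ → Set
    RankBound X r = ∀ I → I ⊆ X → Independent p A₂ I → ∣ I ∣ ≤ r

    -- The restriction of M[A₂] to Y ⁺⟨ hasz , hasγ ⟩ has rank at least s.
    record Rank₂≥ (Y : Subset n) (hasz hasγ : Bool) (s : ℕ) : Set where
      constructor witness
      field
        K           : Subset n
        kz kγ       : Bool
        K⊆Y         : K ⊆ Y
        kz⇒hasz     : kz ⇒ᵇ hasz
        kγ⇒hasγ     : kγ ⇒ᵇ hasγ
        independent : SplitIndependent K kz kγ
        large       : s ≤ ∣ K ∣ + (bit kz + bit kγ)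

    Rank₂≥⇒≤ : ∀ {Y hasz hasγ s r} → Rank₂≥ Y hasz hasγ s → RankBound (Y ⁺⟨ hasz , hasγ ⟩) r → s ≤ r
    Rank₂≥⇒≤ (witness K kz kγ K⊆Y kz⇒ kγ⇒ ind large) bound = ℕₚ.≤-trans large
      (subst (_≤ _) (∣K⁺∣ K kz kγ) (bound _ (⁺-mono K⊆Y kz⇒ kγ⇒) (splitIndependent⇒independent K kz kγ ind)))

    Rank₂≥-mono : ∀ {Y Y′ hasz hasz′ hasγ hasγ′ s s′} → Y ⊆ Y′ → hasz ⇒ᵇ hasz′ → hasγ ⇒ᵇ hasγ′ → s′ ≤ s →
                  Rank₂≥ Y hasz hasγ s → Rank₂≥ Y′ hasz′ hasγ′ s′
    Rank₂≥-mono Y⊆Y′ z⇒z′ γ⇒γ′ s′≤s (witness K kz kγ K⊆Y kz⇒ kγ⇒ ind large) =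
      witness K kz kγ (Y⊆Y′ ∘ K⊆Y) (z⇒z′ ∘ kz⇒) (γ⇒γ′ ∘ kγ⇒) ind (ℕₚ.≤-trans s′≤s large)

    rank₂-z : ∀ Y → Rank₂≥ Y true false (suc (rk Y))
    rank₂-z Y = witness (basis Y) true false (basis⊆ Y) id id
      (independent⇒+z (basis Y) (basis-independent Y))
      (ℕₚ.≤-reflexive (trans (cong suc (sym (∣basis∣ Y))) (ℕₚ.+-comm 1 _)))

    rank₂-E : ∀ Y → Rank₂≥ Y false false (rk Y)
    rank₂-E Y = witness (basis Y) false false (basis⊆ Y) id id
      (splitIndependent-without-z (basis Y) false (independent⇒+z (basis Y) (basis-independent Y)))
      (ℕₚ.≤-reflexive (sym (trans (ℕₚ.+-identityʳ _) (∣basis∣ Y))))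

    e∈basis⁅e⁆ : e ∈ basis ⁅ e ⁆
    e∈basis⁅e⁆ = p⊆⁅x⁆∧1≤∣p∣⇒x∈p (basis ⁅ e ⁆) e (basis⊆ ⁅ e ⁆)
      (subst (1 ≤_) (sym (∣basis∣ ⁅ e ⁆)) (1≤rk⁅x⁆ e))

    rank₂-⊥ : ∀ hasz → Rank₂≥ ⊥ hasz true (bit hasz + 1)
    rank₂-⊥ hasz = witness ⊥ hasz true id id id
      (independent∋e⇒-e+zγ (basis ⁅ e ⁆) ⊥ hasz (basis-independent ⁅ e ⁆) e∈basis⁅e⁆
        (λ x∈⊥ → ⊥-elim (∉⊥ x∈⊥)) ∉⊥)
      (ℕₚ.≤-reflexive (sym (cong (_+ (bit hasz + 1)) (∣⊥∣≡0 n))))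

    rank₂-e+γ : Rank₂≥ ⁅ e ⁆ false true 2
    rank₂-e+γ = witness (basis ⁅ e ⁆) false true (basis⊆ ⁅ e ⁆) id id
      (independent∋e⇒+γ (basis ⁅ e ⁆) (basis-independent ⁅ e ⁆) e∈basis⁅e⁆)
      (subst (2 ≤_) (ℕₚ.+-comm 1 ∣ basis ⁅ e ⁆ ∣) (s≤s (subst (1 ≤_) (sym (∣basis∣ ⁅ e ⁆)) (1≤rk⁅x⁆ e))))

    rank₂-x+zγ : ∀ x → x ≢ e → ∀ hasz → Rank₂≥ ⁅ x ⁆ hasz true (1 + (bit hasz + 1))
    rank₂-x+zγ x x≢e hasz = witness ⁅ x ⁆ hasz true id id id
      (independent∋e⇒-e+zγ I ⁅ x ⁆ hasz (basis-independent _) e∈I ⁅x⁆⊆I (x≢e ∘ sym ∘ x∈⁅y⁆⇒x≡y x))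
      (ℕₚ.≤-reflexive (cong (_+ (bit hasz + 1)) (sym (∣⁅x⁆∣≡1 x))))
      where
      I : Subset n
      I = basis (⁅ x ⁆ ∪ ⁅ e ⁆)
      2≤∣I∣ : 2 ≤ ∣ I ∣
      2≤∣I∣ = subst (2 ≤_) (sym (∣basis∣ _)) (2≤rk⁅x⁆∪⁅y⁆ x e x≢e)
      e∈I : e ∈ I
      e∈I = p⊆⁅x⁆∪⁅y⁆∧2≤∣p∣⇒y∈p I x e (basis⊆ _) 2≤∣I∣
      ⁅x⁆⊆I : ⁅ x ⁆ ⊆ I
      ⁅x⁆⊆I y∈⁅x⁆ = subst (_∈ I) (sym (x∈⁅y⁆⇒x≡y x y∈⁅x⁆))
        (p⊆⁅x⁆∪⁅y⁆∧2≤∣p∣⇒y∈p I e x (⁅x⁆∪⁅y⁆⊆⁅y⁆∪⁅x⁆ x e ∘ basis⊆ _) 2≤∣I∣)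

    basis∁⊆∁ : ∀ X Y → Y ⊆ X → basis (∁ X) ⊆ ∁ Y
    basis∁⊆∁ X Y Y⊆X j∈ = x∉p⇒x∈∁p (x∈∁p⇒x∉p (basis⊆ (∁ X) j∈) ∘ Y⊆X)

    ∉basis∁ : ∀ X {j} → j ∈ X → j ∉ basis (∁ X)
    ∉basis∁ X j∈X j∈ = x∈∁p⇒x∉p (basis⊆ (∁ X) j∈) j∈X

    -- A basis of E − {x, f} spans M, and the new row keeps it independent when e or f is added.
    basis-avoiding-f : Fin n → Subset n
    basis-avoiding-f x = basis (∁ (⁅ x ⁆ ∪ ⁅ f ⁆))

    R≤∣basis-avoiding-f∣ : ∀ x → R ≤ ∣ basis-avoiding-f x ∣
    R≤∣basis-avoiding-f∣ x = subst (R ≤_) (sym (∣basis∣ _)) (R≤rk∁⁅x⁆∪⁅y⁆ x f)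

    basis-avoiding-f⊆∁⁅x⁆ : ∀ x → basis-avoiding-f x ⊆ ∁ ⁅ x ⁆
    basis-avoiding-f⊆∁⁅x⁆ x = basis∁⊆∁ _ ⁅ x ⁆ (p⊆p∪q ⁅ f ⁆)

    rank₂-∁⁅x⁆-adding : ∀ x w → w ≡ e ⊎ w ≡ f → w ≢ x → e ∉ basis-avoiding-f x →
                        Rank₂≥ (∁ ⁅ x ⁆) false false (suc R)
    rank₂-∁⁅x⁆-adding x w w∈ef w≢x e∉I = witness (I ∪ ⁅ w ⁆) false false
      (p⊆q∧x∈q⇒p∪⁅x⁆⊆q (basis-avoiding-f⊆∁⁅x⁆ x) (x∉p⇒x∈∁p (w≢x ∘ x∈⁅y⁆⇒x≡y x)))
      id id
      (independent⇒∪⁅e∨f⁆ I w (basis-independent _) e∉I f∉I w∈ef)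
      (subst (suc R ≤_) (sym (trans (ℕₚ.+-identityʳ _) (∣p∪⁅x⁆∣≡1+∣p∣ I w w∉I))) (s≤s (R≤∣basis-avoiding-f∣ x)))
      where
      I : Subset n
      I = basis-avoiding-f x
      f∉I : f ∉ I
      f∉I = ∉basis∁ _ (y∈⁅x⁆∪⁅y⁆ x f)
      w∉I : w ∉ I
      w∉I = [ (λ w≡e → subst (_∉ I) (sym w≡e) e∉I) , (λ w≡f → subst (_∉ I) (sym w≡f) f∉I) ]′ w∈ef

    rank₂-∁⁅e⁆ : Rank₂≥ (∁ ⁅ e ⁆) false false (suc R)
    rank₂-∁⁅e⁆ = rank₂-∁⁅x⁆-adding e f (inj₂ refl) f≢e (∉basis∁ _ (x∈⁅x⁆∪⁅y⁆ e f))

    rank₂-∁⁅x⁆+γ : ∀ x → Rank₂≥ (∁ ⁅ x ⁆) false true (suc R)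
    rank₂-∁⁅x⁆+γ x with x F.≟ e | e ∈? basis-avoiding-f x
    ... | yes refl | _      = Rank₂≥-mono id id (λ ()) ℕₚ.≤-refl rank₂-∁⁅e⁆
    ... | no x≢e   | no e∉I =
      Rank₂≥-mono id id (λ ()) ℕₚ.≤-refl (rank₂-∁⁅x⁆-adding x e (inj₁ refl) (x≢e ∘ sym) e∉I)
    ... | no x≢e   | yes e∈I = witness (basis-avoiding-f x) false true (basis-avoiding-f⊆∁⁅x⁆ x) id id
      (independent∋e⇒+γ _ (basis-independent _) e∈I)
      (subst (suc R ≤_) (ℕₚ.+-comm 1 _) (s≤s (R≤∣basis-avoiding-f∣ x)))

    x∈Y⇒1≤rk : ∀ {Y x} → x ∈ Y → 1 ≤ rk Y
    x∈Y⇒1≤rk {x = x} x∈Y = ℕₚ.≤-trans (1≤rk⁅x⁆ x) (rk-mono (x∈p⇒⁅x⁆⊆p x∈Y))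

    small+z : ∀ Y → ∣ Y ∣ ≤ 1 → Rank₂≥ Y true false (∣ Y ∣ + 1)
    small+z Y ∣Y∣≤1 = Rank₂≥-mono id id id
      (subst (_≤ suc (rk Y)) (ℕₚ.+-comm 1 ∣ Y ∣) (s≤s ∣Y∣≤rk)) (rank₂-z Y)
      where
      ∣Y∣≤rk : ∣ Y ∣ ≤ rk Y
      ∣Y∣≤rk with nonempty? Y
      ... | yes (x , x∈Y) = ℕₚ.≤-trans ∣Y∣≤1 (x∈Y⇒1≤rk x∈Y)
      ... | no empty      = subst (_≤ rk Y) (sym (∀x∉p⇒∣p∣≡0 Y (λ x x∈Y → empty (x , x∈Y)))) z≤n

    small+γ : ∀ Y → ∣ Y ∣ ≤ 1 → Rank₂≥ Y false true (∣ Y ∣ + 1)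
    small+γ Y ∣Y∣≤1 with nonempty? Y
    ... | no empty = Rank₂≥-mono (λ x∈⊥ → ⊥-elim (∉⊥ x∈⊥)) id id
          (ℕₚ.≤-reflexive (cong (_+ 1) (∀x∉p⇒∣p∣≡0 Y (λ x x∈Y → empty (x , x∈Y))))) (rank₂-⊥ false)
    ... | yes (x , x∈Y) with x F.≟ e
    ...   | yes refl = Rank₂≥-mono (x∈p⇒⁅x⁆⊆p x∈Y) id id (ℕₚ.+-monoˡ-≤ 1 ∣Y∣≤1) rank₂-e+γ
    ...   | no x≢e   = Rank₂≥-mono (x∈p⇒⁅x⁆⊆p x∈Y) id id (ℕₚ.+-monoˡ-≤ 1 ∣Y∣≤1)
                         (rank₂-x+zγ x x≢e false)

    module Sides (S₀ : Subset n) (hasγ : Bool) {rS rT : ℕ}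
                 (boundS : RankBound (S₀ ⁺⟨ true , hasγ ⟩) rS)
                 (boundT : RankBound (∁ S₀ ⁺⟨ false , not hasγ ⟩) rT) where

      S≥ : ∀ {Y hasz′ hasγ′ s} → Y ⊆ S₀ → hasγ′ ⇒ᵇ hasγ → Rank₂≥ Y hasz′ hasγ′ s → s ≤ rS
      S≥ Y⊆S₀ γ⇒ rank≥ = Rank₂≥⇒≤ (Rank₂≥-mono Y⊆S₀ (λ _ → refl) γ⇒ ℕₚ.≤-refl rank≥) boundS

      T≥ : ∀ {Y hasγ′ s} → Y ⊆ ∁ S₀ → hasγ′ ⇒ᵇ not hasγ → Rank₂≥ Y false hasγ′ s → s ≤ rT
      T≥ Y⊆T₀ γ⇒ rank≥ = Rank₂≥⇒≤ (Rank₂≥-mono Y⊆T₀ id γ⇒ ℕₚ.≤-refl rank≥) boundT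

      combine : ∀ {k a b} → k + suc R ≤ a + b → a ≤ rS → b ≤ rT → k + suc R ≤ rS + rT
      combine k≤ a≤rS b≤rT = ℕₚ.≤-trans k≤ (ℕₚ.+-mono-≤ a≤rS b≤rT)

    balanced : ∀ k S₀ hasγ {rS rT} → 1 ≤ k → k ≤ 2 → k ≤ ∣ S₀ ∣ → k ≤ ∣ ∁ S₀ ∣ →
               RankBound (S₀ ⁺⟨ true , hasγ ⟩) rS → RankBound (∁ S₀ ⁺⟨ false , not hasγ ⟩) rT →
               k + suc R ≤ rS + rT
    balanced k S₀ hasγ 1≤k k≤2 k≤∣S₀∣ k≤∣T₀∣ boundS boundT =
      combine (ℕₚ.≤-trans (ℕₚ.≤-reflexive (ℕₚ.+-suc k R)) (s≤s (rank-sum k S₀ 1≤k k≤2 k≤∣S₀∣ k≤∣T₀∣)))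
        (S≥ id (λ ()) (rank₂-z S₀)) (T≥ id (λ ()) (rank₂-E (∁ S₀)))
      where open Sides S₀ hasγ boundS boundT

    small-S₀ : ∀ k S₀ hasγ {rS rT} → k ≤ 2 → k ≤ ∣ S₀ ⁺⟨ true , hasγ ⟩ ∣ → ∣ S₀ ∣ < k →
               RankBound (S₀ ⁺⟨ true , hasγ ⟩) rS → RankBound (∁ S₀ ⁺⟨ false , not hasγ ⟩) rT →
               k + suc R ≤ rS + rT
    small-S₀ k S₀ false k≤2 k≤∣S∣ ∣S₀∣<k boundS boundT =
      combine (ℕₚ.+-monoˡ-≤ (suc R) (subst (k ≤_) (∣K⁺∣ S₀ true false) k≤∣S∣))
        (S≥ id id (small+z S₀ (ℕₚ.≤-pred (ℕₚ.≤-trans ∣S₀∣<k k≤2))))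
        (T≥ (p⊆q⇒∁p⊇∁q (proj₂ (∣p∣≤1⇒∃p⊆⁅x⁆ e S₀ (ℕₚ.≤-pred (ℕₚ.≤-trans ∣S₀∣<k k≤2)))))
            id (rank₂-∁⁅x⁆+γ _))
      where open Sides S₀ false boundS boundT
    small-S₀ k S₀ true k≤2 _ ∣S₀∣<k boundS boundT
      with ∣p∣≤1⇒p⊆⁅y⁆⊎p⊆⁅x⁆ e S₀ (ℕₚ.≤-pred (ℕₚ.≤-trans ∣S₀∣<k k≤2))
    ... | inj₁ S₀⊆⁅e⁆ = combine (ℕₚ.+-monoˡ-≤ (suc R) k≤2)
      (S≥ (λ x∈⊥ → ⊥-elim (∉⊥ x∈⊥)) id (rank₂-⊥ true))
      (T≥ (p⊆q⇒∁p⊇∁q S₀⊆⁅e⁆) (λ ()) rank₂-∁⁅e⁆)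
      where open Sides S₀ true boundS boundT
    ... | inj₂ (x , x≢e , x∈S₀ , S₀⊆⁅x⁆) = combine (ℕₚ.+-monoˡ-≤ (suc R) k≤2)
      (S≥ (x∈p⇒⁅x⁆⊆p x∈S₀) id (rank₂-x+zγ x x≢e true))
      (T≥ id (λ ()) (Rank₂≥-mono id id id
        (ℕₚ.≤-trans (R≤rk∁⁅x⁆ x) (rk-mono (p⊆q⇒∁p⊇∁q S₀⊆⁅x⁆))) (rank₂-E (∁ S₀))))
      where open Sides S₀ true boundS boundT

    small-T₀ : ∀ k S₀ hasγ {rS rT} → k ≤ 2 → k ≤ ∣ ∁ S₀ ⁺⟨ false , not hasγ ⟩ ∣ → ∣ ∁ S₀ ∣ < k →
               RankBound (S₀ ⁺⟨ true , hasγ ⟩) rS → RankBound (∁ S₀ ⁺⟨ false , not hasγ ⟩) rT →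
               k + suc R ≤ rS + rT
    small-T₀ k S₀ true _ k≤∣T∣ ∣T₀∣<k _ _ =
      ⊥-elim (ℕₚ.<⇒≱ ∣T₀∣<k (subst (k ≤_) (trans (∣K⁺∣ (∁ S₀) false false) (ℕₚ.+-identityʳ _)) k≤∣T∣))
    small-T₀ k S₀ false k≤2 k≤∣T∣ ∣T₀∣<k boundS boundT =
      combine (ℕₚ.≤-trans (ℕₚ.+-monoˡ-≤ (suc R) (subst (k ≤_) (∣K⁺∣ (∁ S₀) false true) k≤∣T∣))
                          (ℕₚ.≤-reflexive (ℕₚ.+-comm _ (suc R))))
        (S≥ ∁⁅x⁆⊆S₀ (λ ()) (Rank₂≥-mono id id id (s≤s (R≤rk∁⁅x⁆ x)) (rank₂-z (∁ ⁅ x ⁆))))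
        (T≥ id id (small+γ (∁ S₀) ∣T₀∣≤1))
      where
      open Sides S₀ false boundS boundT
      ∣T₀∣≤1 : ∣ ∁ S₀ ∣ ≤ 1
      ∣T₀∣≤1 = ℕₚ.≤-pred (ℕₚ.≤-trans ∣T₀∣<k k≤2)
      x : Fin n
      x = proj₁ (∣p∣≤1⇒∃p⊆⁅x⁆ e (∁ S₀) ∣T₀∣≤1)
      ∁⁅x⁆⊆S₀ : ∁ ⁅ x ⁆ ⊆ S₀
      ∁⁅x⁆⊆S₀ = subst (∁ ⁅ x ⁆ ⊆_) (∁-involutive S₀) (p⊆q⇒∁p⊇∁q (proj₂ (∣p∣≤1⇒∃p⊆⁅x⁆ e (∁ S₀) ∣T₀∣≤1)))

    z-side-sum : ∀ k S₀ hasγ {rS rT} → 1 ≤ k → k ≤ 2 →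
                 k ≤ ∣ S₀ ⁺⟨ true , hasγ ⟩ ∣ → k ≤ ∣ ∁ S₀ ⁺⟨ false , not hasγ ⟩ ∣ →
                 RankBound (S₀ ⁺⟨ true , hasγ ⟩) rS → RankBound (∁ S₀ ⁺⟨ false , not hasγ ⟩) rT →
                 k + suc R ≤ rS + rT
    z-side-sum k S₀ hasγ 1≤k k≤2 k≤∣S∣ k≤∣T∣ boundS boundT with k ℕ.≤? ∣ S₀ ∣ | k ℕ.≤? ∣ ∁ S₀ ∣
    ... | yes k≤∣S₀∣ | yes k≤∣T₀∣ = balanced k S₀ hasγ 1≤k k≤2 k≤∣S₀∣ k≤∣T₀∣ boundS boundT
    ... | no k≰∣S₀∣  | _          = small-S₀ k S₀ hasγ k≤2 k≤∣S∣ (ℕₚ.≰⇒> k≰∣S₀∣) boundS boundT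
    ... | yes _      | no k≰∣T₀∣  = small-T₀ k S₀ hasγ k≤2 k≤∣T∣ (ℕₚ.≰⇒> k≰∣T₀∣) boundS boundT

    RankSum₂ : ℕ → Subset (suc (suc n)) → ℕ → ℕ → Set
    RankSum₂ k S rS rT =
      k ≤ ∣ S ∣ → k ≤ ∣ ∁ S ∣ → RankBound S rS → RankBound (∁ S) rT → k + suc R ≤ rS + rT

    -- Complementing if necessary, z lies on the first side.
    rank-sum₂ : ∀ k S {rS rT} → 1 ≤ k → k ≤ 2 → RankSum₂ k S rS rT
    rank-sum₂ k S {rS} {rT} 1≤k k≤2 =
      subst (λ S → RankSum₂ k S rS rT) (onE⁺ S) (split-sum (onE S) (z∈? S) (γ∈? S))
      where
      split-sum : ∀ K hasz hasγ → RankSum₂ k (K ⁺⟨ hasz , hasγ ⟩) rS rT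
      split-sum K true hasγ k≤∣S∣ k≤∣∁S∣ boundS bound∁S =
        z-side-sum k K hasγ 1≤k k≤2 k≤∣S∣ (subst (λ T → k ≤ ∣ T ∣) (∁-⁺ K true hasγ) k≤∣∁S∣)
          boundS (subst (λ T → RankBound T rT) (∁-⁺ K true hasγ) bound∁S)
      split-sum K false hasγ k≤∣S∣ k≤∣∁S∣ boundS bound∁S =
        subst (k + suc R ≤_) (ℕₚ.+-comm rT rS)
          (z-side-sum k (∁ K) (not hasγ) 1≤k k≤2 (subst (λ T → k ≤ ∣ T ∣) (∁-⁺ K false hasγ) k≤∣∁S∣)
            (subst (λ T → k ≤ ∣ T ∣) (sym ∁∁K⁺) k≤∣S∣)
            (subst (λ T → RankBound T rT) (∁-⁺ K false hasγ) bound∁S)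
            (subst (λ T → RankBound T rS) (sym ∁∁K⁺) boundS))
        where
        ∁∁K⁺ : ∁ (∁ K) ⁺⟨ false , not (not hasγ) ⟩ ≡ K ⁺⟨ false , hasγ ⟩
        ∁∁K⁺ = cong₂ (λ L b → L ⁺⟨ false , b ⟩) (∁-involutive K) (not-involutive hasγ)

    rank₂-⊤≤ : ∀ r → IsRank p A₂ ⊤ r → r ≤ suc R
    rank₂-⊤≤ r ((J , _ , ind , ∣J∣≡r) , _) =
      subst (_≤ suc R) (trans (sym (∣K⁺∣ (onE J) (z∈? J) (γ∈? J))) (trans (cong ∣_∣ (onE⁺ J)) ∣J∣≡r))
        (SizeBound.size-bound R (λ I → rk-maximal ⊤ I (λ _ → ∈⊤)) (onE J) (z∈? J) (γ∈? J)
          (independent⇒splitIndependent (onE J) (z∈? J) (γ∈? J) (subst (Independent p A₂) (sym (onE⁺ J)) ind)))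

    no-separation₂ : ∀ k S → 1 ≤ k → k ≤ 2 → ¬ Separation p k A₂ S
    no-separation₂ k S 1≤k k≤2 (k≤∣S∣ , k≤∣∁S∣ , rS , rT , r , rank-S , rank-∁S , rank-⊤ , rS+rT<k+r) =
      ℕₚ.<⇒≱ rS+rT<k+r (ℕₚ.≤-trans (ℕₚ.+-monoʳ-≤ k (rank₂-⊤≤ r rank-⊤))
        (rank-sum₂ k S 1≤k k≤2 k≤∣S∣ k≤∣∁S∣ (proj₂ rank-S) (proj₂ rank-∁S)))

    threeConnected₂ : ThreeConnected p A₂
    threeConnected₂ S = no-separation₂ 1 S ℕₚ.≤-refl (s≤s z≤n) , no-separation₂ 2 S (s≤s z≤n) ℕₚ.≤-refl


theorem3p4 : (p : ℕ) .{{_ : NonZero p}} → Prime p →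
    ∀ (m n : ℕ) (A : Matrix p m n) →
    Simple p A → Coloopless p A → ThreeConnected p A → 4 < n →
    ∀ (a b : Fin n) → a ≢ b →
    ∀ (α : GF p) → α ≢ 0F p →
    ∀ (e : Fin n) → (e ≡ a ⊎ e ≡ b) →
    ThreeConnected p (Aᵉ p A a b α e)
theorem3p4 p pr m n A _ _ tc n>4 a b a≢b α α≢0 e e∈ab =
  Splitting.Connectivity.threeConnected₂ p pr A a b a≢b α α≢0 e e∈ab tc n>4
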